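{- Let $G$ be an edge-transitive finite simple graph with at least one edge and without isolated edges (no connected component isomorphic to $K_2$), and let $H=G-e'$ be obtained by deleting some edge $e'$ of $G$. Then $p_G(x)=p_H(x)$.
   Context: A graph is edge-transitive if for any two edges $e_1,e_2$ there is a graph automorphism mapping $e_1$ to $e_2$. Forest building process: for a finite simple graph $G$ with $m$ edges, choose an ordering $e_1,\dots,e_m$ of $E(G)$ uniformly at random; start with no edges on $V(G)$ and for $j=1,\dots,m$ keep $e_j$ if and only if $e_j$ is incident to a vertex not incident to any $e_i$ with $i<j$. $P(G,k)$ is the probability that the resulting forest has exactly $k$ connected components, where isolated vertices of the graph do not contribute to the component count. $p_G(x)=\sum_kP(G,k)x^k$. -}

module Defs where

open import Data.Bool using (Bool; true; false; _∧_; _∨_; not; if_then_else_)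
open import Data.Nat using (ℕ; zero; suc; _<ᵇ_; _≡ᵇ_; _!)
open import Data.Nat.Properties using (_!≢0)
open import Data.Fin using (Fin; toℕ)
open import Data.List using (List; []; _∷_; map; concatMap; length)
open import Data.Bool.ListAction using (any; all)
open import Data.List.Base using (allFin)
open import Data.Product using (_×_; _,_; ∃; Σ)
open import Data.Sum using (_⊎_)
open import Data.Integer using (+_)
open import Data.Rational using (ℚ; _/_)
open import Data.Fin.Permutation using (Permutation′; _⟨$⟩ʳ_)
open import Relation.Binary.PropositionalEquality using (_≡_)
open import Relation.Nullary using (¬_)

record Graph : Set where
  field
    n   : ℕ
    adj : Fin n → Fin n → Bool
open Graph public

IsSimple : Graph → Set
IsSimple G = (∀ i j → adj G i j ≡ adj G j i) × (∀ i → adj G i i ≡ false)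

_==_ : ∀ {k} → Fin k → Fin k → Bool
a == b = toℕ a ≡ᵇ toℕ b

filterᵇ : ∀ {A : Set} → (A → Bool) → List A → List A
filterᵇ p [] = []
filterᵇ p (x ∷ xs) = if p x then x ∷ filterᵇ p xs else filterᵇ p xs

countᵇ : ∀ {A : Set} → (A → Bool) → List A → ℕ
countᵇ p xs = length (filterᵇ p xs)

Edge : ℕ → Set
Edge k = Fin k × Fin k

edges : (G : Graph) → List (Edge (n G))
edges G = filterᵇ (λ { (i , j) → (toℕ i <ᵇ toℕ j) ∧ adj G i j })
            (concatMap (λ i → map (λ j → (i , j)) (allFin (n G))) (allFin (n G)))

insertions : ∀ {A : Set} → A → List A → List (List A)
insertions x [] = (x ∷ []) ∷ []
insertions x (y ∷ ys) = (x ∷ y ∷ ys) ∷ map (y ∷_) (insertions x ys)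

perms : ∀ {A : Set} → List A → List (List A)
perms [] = [] ∷ []
perms (x ∷ xs) = concatMap (insertions x) (perms xs)

-- The forest building process: `covered` records the vertices incident to
-- an edge processed earlier; e_j is kept iff one of its endpoints is uncovered.
process : ∀ {k} → (Fin k → Bool) → List (Edge k) → List (Edge k)
process covered [] = []
process covered ((u , v) ∷ es) =
  if not (covered u) ∨ not (covered v)
    then (u , v) ∷ process covered' es
    else process covered' es
  where
  covered' : _ → Bool
  covered' w = covered w ∨ (w == u) ∨ (w == v)

incident : ∀ {k} → List (Edge k) → Fin k → Bool
incident F w = any (λ { (a , b) → (w == a) ∨ (w == b) }) F

step : ∀ {k} → List (Edge k) → (Fin k → Bool) → (Fin k → Bool)
step F S w = S w ∨ any (λ { (a , b) → (S a ∧ (w == b)) ∨ (S b ∧ (w == a)) }) F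

iter : ∀ {A : Set} → ℕ → (A → A) → A → A
iter zero f x = x
iter (suc m) f x = f (iter m f x)

-- reachable F v w : w is joined to v by a path in F (paths have < k edges).
reachable : ∀ {k} → List (Edge k) → Fin k → Fin k → Bool
reachable {k} F v = iter k (step F) (λ w → w == v)

-- number of components = number of non-isolated vertices v that are the
-- least vertex (w.r.t. Fin order) of their connected component.
components : ∀ {k} → List (Edge k) → ℕ
components {k} F =
  countᵇ (λ v → incident F v ∧
                 all (λ w → not ((toℕ w <ᵇ toℕ v) ∧ reachable F v w)) (allFin k))
         (allFin k)

P : Graph → ℕ → ℚ
P G c = (+ countᵇ (λ ord → components (process (λ _ → false) ord) ≡ᵇ c) (perms (edges G)))
        / (length (edges G) !)
  where instance _ = length (edges G) !≢0

IsAutomorphism : (G : Graph) → Permutation′ (n G) → Set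
IsAutomorphism G σ = ∀ i j → adj G (σ ⟨$⟩ʳ i) (σ ⟨$⟩ʳ j) ≡ adj G i j

EdgeTransitive : Graph → Set
EdgeTransitive G = ∀ u v x y → adj G u v ≡ true → adj G x y ≡ true →
  ∃ λ (σ : Permutation′ (n G)) → IsAutomorphism G σ ×
    (((σ ⟨$⟩ʳ u ≡ x) × (σ ⟨$⟩ʳ v ≡ y)) ⊎ ((σ ⟨$⟩ʳ u ≡ y) × (σ ⟨$⟩ʳ v ≡ x)))

HasEdge : Graph → Set
HasEdge G = ∃ λ u → ∃ λ v → adj G u v ≡ true

-- An isolated edge: an edge uv forming a connected component ≅ K₂,
-- i.e. v is the only neighbour of u and u is the only neighbour of v.
NoIsolatedEdge : Graph → Set
NoIsolatedEdge G = ∀ u v → adj G u v ≡ true →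
  ¬ ((∀ w → adj G u w ≡ true → w ≡ v) × (∀ w → adj G v w ≡ true → w ≡ u))

deleteEdge : (G : Graph) → Fin (n G) → Fin (n G) → Graph
deleteEdge G u v = record
  { n = n G
  ; adj = λ i j → adj G i j ∧ not (((i == u) ∧ (j == v)) ∨ ((i == v) ∧ (j == u))) }

-- Sum over the orderings of E(G) according to their last edge e = ab. Since G has no isolated edge,
-- a or b has a neighbour off e, so the earlier edges already cover an endpoint of e: the last step
-- either discards e or attaches it as a leaf, and the number of components is that of the forest
-- built from the other edges in their order. An automorphism of G carrying e to the deleted edge
-- e′ maps the orderings of E(G) − e bijectively onto those of E(H), preserving that number. Hence
-- each of the m choices of last edge reproduces the count for H, and m · (m − 1)! = m! gives p_G = p_H.

module Submission where

open import Defs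
open import Data.Bool using (true)
open import Data.Nat using (ℕ)
open import Data.Fin using (Fin)
open import Relation.Binary.PropositionalEquality using (_≡_)

module Booleans where

  open import Data.Bool using (Bool; true; false; _∧_; _∨_; not)
  open import Data.Bool.Properties using (T-≡)
  open import Data.Nat using (_+_; _<_; _≤_; _<ᵇ_; z≤n; s≤s)
  open import Data.Nat.Properties using (≡ᵇ⇒≡; ≡⇒≡ᵇ; <ᵇ⇒<; <⇒<ᵇ; ≤-trans; +-suc; m≤n⇒m≤1+n; n≤1+n)
  open import Data.Fin using (toℕ)
  open import Data.Fin.Properties using (toℕ-injective)
  open import Data.List using (List; []; _∷_; length)
  open import Data.Bool.ListAction using (any; all)
  open import Data.List.Membership.Propositional using (_∈_)
  open import Data.List.Relation.Unary.Any using (here; there)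
  open import Data.Product using (_×_; _,_; ∃; proj₁; proj₂)
  open import Data.Sum using (_⊎_; inj₁; inj₂)
  open import Data.Empty using (⊥-elim)
  open import Function.Bundles using (Equivalence)
  open import Relation.Binary.PropositionalEquality

  open Equivalence using (to; from)

  χ : Bool → ℕ
  χ true = 1
  χ false = 0

  true≢false : true ≢ false
  true≢false ()

  ¬true⇒false : ∀ {b} → b ≢ true → b ≡ false
  ¬true⇒false {true} h = ⊥-elim (h refl)
  ¬true⇒false {false} h = refl

  ∨-true⁻ : ∀ a b → a ∨ b ≡ true → a ≡ true ⊎ b ≡ true
  ∨-true⁻ true b _ = inj₁ refl
  ∨-true⁻ false b e = inj₂ e

  ∧-true⁻ : ∀ a b → a ∧ b ≡ true → a ≡ true × b ≡ true
  ∧-true⁻ true true _ = refl , refl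

  ∨-true⁺ʳ : ∀ a {b} → b ≡ true → a ∨ b ≡ true
  ∨-true⁺ʳ true _ = refl
  ∨-true⁺ʳ false e = e

  ∨-true⁺ˡ : ∀ {a} b → a ≡ true → a ∨ b ≡ true
  ∨-true⁺ˡ b refl = refl

  bool-ext : ∀ {x y : Bool} → (x ≡ true → y ≡ true) → (y ≡ true → x ≡ true) → x ≡ y
  bool-ext {true} {true} f g = refl
  bool-ext {true} {false} f g = sym (f refl)
  bool-ext {false} {true} f g = g refl
  bool-ext {false} {false} f g = refl

  module _ {k : ℕ} where
    ==⇒≡ : {a b : Fin k} → (a == b) ≡ true → a ≡ b
    ==⇒≡ {a} {b} e = toℕ-injective (≡ᵇ⇒≡ (toℕ a) (toℕ b) (from T-≡ e))

    ≡⇒== : {a b : Fin k} → a ≡ b → (a == b) ≡ true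
    ≡⇒== {a} {b} e = to T-≡ (≡⇒≡ᵇ (toℕ a) (toℕ b) (cong toℕ e))

    ==-refl : (a : Fin k) → (a == a) ≡ true
    ==-refl a = ≡⇒== {a = a} refl

    ≢⇒== : {a b : Fin k} → a ≢ b → (a == b) ≡ false
    ≢⇒== {a} {b} ne = ¬true⇒false (λ e → ne (==⇒≡ {a = a} e))

  <ᵇ-true⇒< : ∀ {m n} → (m <ᵇ n) ≡ true → m < n
  <ᵇ-true⇒< {m} {n} e = <ᵇ⇒< m n (from T-≡ e)

  <⇒<ᵇ-true : ∀ {m n} → m < n → (m <ᵇ n) ≡ true
  <⇒<ᵇ-true p = to T-≡ (<⇒<ᵇ p)

  module _ {A : Set} where
    any-true⁻ : ∀ (p : A → Bool) xs → any p xs ≡ true → ∃ λ x → x ∈ xs × p x ≡ true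
    any-true⁻ p (x ∷ xs) e with ∨-true⁻ (p x) (any p xs) e
    ... | inj₁ px = x , here refl , px
    ... | inj₂ r with any-true⁻ p xs r
    ... | y , m , py = y , there m , py

    any-true⁺ : ∀ (p : A → Bool) {xs x} → x ∈ xs → p x ≡ true → any p xs ≡ true
    any-true⁺ p {x ∷ xs} (here refl) px = ∨-true⁺ˡ (any p xs) px
    any-true⁺ p {x ∷ xs} (there m) py = ∨-true⁺ʳ (p x) (any-true⁺ p m py)

    any-cong : ∀ {p q : A → Bool} → (∀ x → p x ≡ q x) → ∀ xs → any p xs ≡ any q xs
    any-cong e [] = refl
    any-cong e (x ∷ xs) = cong₂ _∨_ (e x) (any-cong e xs)

    all-true⁻ : ∀ (p : A → Bool) {xs x} → all p xs ≡ true → x ∈ xs → p x ≡ true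
    all-true⁻ p {x ∷ xs} e (here refl) = proj₁ (∧-true⁻ (p x) (all p xs) e)
    all-true⁻ p {x ∷ xs} e (there m) = all-true⁻ p (proj₂ (∧-true⁻ (p x) (all p xs) e)) m

    all-true⁺ : ∀ (p : A → Bool) xs → (∀ x → x ∈ xs → p x ≡ true) → all p xs ≡ true
    all-true⁺ p [] h = refl
    all-true⁺ p (x ∷ xs) h rewrite h x (here refl) = all-true⁺ p xs (λ y m → h y (there m))

    all-cong : ∀ {p q : A → Bool} → (∀ x → p x ≡ q x) → ∀ xs → all p xs ≡ all q xs
    all-cong e [] = refl
    all-cong e (x ∷ xs) = cong₂ _∧_ (e x) (all-cong e xs)

    count-cons : ∀ (p : A → Bool) x xs → countᵇ p (x ∷ xs) ≡ χ (p x) + countᵇ p xs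
    count-cons p x xs with p x
    ... | true = refl
    ... | false = refl

    count-cong : ∀ {p q : A → Bool} → (∀ x → p x ≡ q x) → ∀ xs → countᵇ p xs ≡ countᵇ q xs
    count-cong e [] = refl
    count-cong {p} {q} e (x ∷ xs) =
      trans (count-cons p x xs) (trans (cong₂ _+_ (cong χ (e x)) (count-cong e xs)) (sym (count-cons q x xs)))

    count-split : ∀ (p d : A → Bool) xs → countᵇ p xs ≡ countᵇ (λ x → p x ∧ d x) xs + countᵇ (λ x → p x ∧ not (d x)) xs
    count-split p d [] = refl
    count-split p d (x ∷ xs) = trans (count-cons p x xs) (trans (cong (χ (p x) +_) (count-split p d xs))
      (trans (χ-split (p x) (d x) _ _) (sym (cong₂ _+_ (count-cons (λ x → p x ∧ d x) x xs) (count-cons (λ x → p x ∧ not (d x)) x xs)))))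
      where
      χ-split : ∀ a b m n → χ a + (m + n) ≡ (χ (a ∧ b) + m) + (χ (a ∧ not b) + n)
      χ-split false b m n = refl
      χ-split true true m n = refl
      χ-split true false m n = sym (+-suc m n)

    count-le : ∀ (p : A → Bool) xs → countᵇ p xs ≤ length xs
    count-le p [] = z≤n
    count-le p (x ∷ xs) with p x
    ... | true = s≤s (count-le p xs)
    ... | false = m≤n⇒m≤1+n (count-le p xs)

    count-mono : ∀ {p q : A → Bool} → (∀ x → p x ≡ true → q x ≡ true) → ∀ xs → countᵇ p xs ≤ countᵇ q xs
    count-mono h [] = z≤n
    count-mono {p} {q} h (x ∷ xs) with p x in ep | q x in eq
    ... | true | true = s≤s (count-mono h xs)
    ... | true | false = ⊥-elim (true≢false (trans (sym (h x ep)) eq))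
    ... | false | true = m≤n⇒m≤1+n (count-mono h xs)
    ... | false | false = count-mono h xs

    count-mono-< : ∀ {p q : A → Bool} → (∀ x → p x ≡ true → q x ≡ true) → ∀ {xs w} → w ∈ xs → q w ≡ true → p w ≡ false →
      countᵇ p xs < countᵇ q xs
    count-mono-< {p} {q} h {x ∷ xs} (here refl) qw pw rewrite qw | pw = s≤s (count-mono h xs)
    count-mono-< {p} {q} h {x ∷ xs} (there m) qw pw with p x in ep | q x in eq
    ... | true | true = s≤s (count-mono-< h m qw pw)
    ... | true | false = ⊥-elim (true≢false (trans (sym (h x ep)) eq))
    ... | false | true = ≤-trans (count-mono-< h m qw pw) (n≤1+n _)
    ... | false | false = count-mono-< h m qw pw

    count-pos : ∀ (p : A → Bool) {xs x} → x ∈ xs → p x ≡ true → 1 ≤ countᵇ p xs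
    count-pos p {x ∷ xs} (here refl) px rewrite px = s≤s z≤n
    count-pos p {y ∷ xs} (there m) px with p y
    ... | true = s≤s z≤n
    ... | false = count-pos p m px


module PermutationSums where

  open import Data.Nat using (suc; _+_; _*_)
  open import Data.Nat.Properties using (+-assoc; +-commutativeSemigroup)
  open import Algebra.Properties.CommutativeSemigroup +-commutativeSemigroup using (interchange; x∙yz≈y∙xz)
  open import Data.Nat.Tactic.RingSolver using (solve-∀)
  open import Data.Bool using (Bool)
  open import Data.List using (List; []; _∷_; map; concatMap; length; _++_; [_])
  open import Data.List.Properties using (map-∘; length-map)
  open import Data.List.Membership.Propositional using (_∈_)
  open import Data.List.Membership.Propositional.Properties using (∈-map⁻)
  open import Data.List.Relation.Unary.All as All using (_∷_)
  open import Data.List.Relation.Unary.Any using (here; there)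
  open import Data.List.Relation.Unary.Unique.Propositional using (Unique)
  open import Data.List.Relation.Unary.AllPairs using (_∷_)
  open import Data.List.Relation.Binary.Permutation.Propositional using (_↭_; ↭-refl; ↭-prep; ↭-swap; ↭-trans)
  import Data.List.Relation.Binary.Permutation.Propositional as ↭
  open import Data.List.Relation.Binary.Permutation.Propositional.Properties using (∈-resp-↭)
  open import Data.Product using (_×_; _,_)
  open import Function using (_∘_)
  open import Relation.Binary.PropositionalEquality
    using (_≢_; refl; sym; trans; cong; cong₂; module ≡-Reasoning)
  open ≡-Reasoning
  open Booleans using (χ; count-cons)

  module _ {B : Set} where
    sumMap : (B → ℕ) → List B → ℕ
    sumMap f [] = 0
    sumMap f (x ∷ xs) = f x + sumMap f xs

    sumMap-++ : ∀ f xs ys → sumMap f (xs ++ ys) ≡ sumMap f xs + sumMap f ys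
    sumMap-++ f [] ys = refl
    sumMap-++ f (x ∷ xs) ys = trans (cong (f x +_) (sumMap-++ f xs ys)) (sym (+-assoc (f x) _ _))

    sumMap-cong∈ : ∀ {f g} xs → (∀ {x} → x ∈ xs → f x ≡ g x) → sumMap f xs ≡ sumMap g xs
    sumMap-cong∈ [] e = refl
    sumMap-cong∈ (x ∷ xs) e = cong₂ _+_ (e (here refl)) (sumMap-cong∈ xs (e ∘ there))

    sumMap-cong : ∀ {f g} → (∀ x → f x ≡ g x) → ∀ xs → sumMap f xs ≡ sumMap g xs
    sumMap-cong e xs = sumMap-cong∈ xs (λ {x} _ → e x)

    sumMap-+ : ∀ f g xs → sumMap (λ x → f x + g x) xs ≡ sumMap f xs + sumMap g xs
    sumMap-+ f g [] = refl
    sumMap-+ f g (x ∷ xs) = trans (cong (f x + g x +_) (sumMap-+ f g xs)) (interchange (f x) (g x) _ _)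

    sumMap-const : ∀ c xs → sumMap (λ _ → c) xs ≡ length xs * c
    sumMap-const c [] = refl
    sumMap-const c (x ∷ xs) = cong (c +_) (sumMap-const c xs)

    countᵇ≡sumMap : ∀ (p : B → Bool) xs → countᵇ p xs ≡ sumMap (χ ∘ p) xs
    countᵇ≡sumMap p [] = refl
    countᵇ≡sumMap p (x ∷ xs) = trans (count-cons p x xs) (cong (χ (p x) +_) (countᵇ≡sumMap p xs))

  sumMap-map : ∀ {B C : Set} (f : C → ℕ) (g : B → C) xs → sumMap f (map g xs) ≡ sumMap (f ∘ g) xs
  sumMap-map f g [] = refl
  sumMap-map f g (x ∷ xs) = cong (f (g x) +_) (sumMap-map f g xs)

  sumMap-concatMap : ∀ {B C : Set} (f : C → ℕ) (g : B → List C) xs →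
    sumMap f (concatMap g xs) ≡ sumMap (sumMap f ∘ g) xs
  sumMap-concatMap f g [] = refl
  sumMap-concatMap f g (x ∷ xs) = trans (sumMap-++ f (g x) _) (cong (sumMap f (g x) +_) (sumMap-concatMap f g xs))

  module _ {A : Set} where
    sumPerms : (List A → ℕ) → List A → ℕ
    sumPerms h L = sumMap h (perms L)

    sumInsertions : A → (List A → ℕ) → List A → ℕ
    sumInsertions x h p = sumMap h (insertions x p)

    sumPerms-∷ : ∀ x xs h → sumPerms h (x ∷ xs) ≡ sumPerms (sumInsertions x h) xs
    sumPerms-∷ x xs h = sumMap-concatMap h (insertions x) (perms xs)

    sumInsertions-∷ : ∀ x z p h → sumInsertions x h (z ∷ p) ≡ h (x ∷ z ∷ p) + sumInsertions x (h ∘ (z ∷_)) p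
    sumInsertions-∷ x z p h = cong (h (x ∷ z ∷ p) +_) (sumMap-map h (z ∷_) (insertions x p))

    sumInsertions-cong : ∀ x {h h'} → (∀ q → h q ≡ h' q) → ∀ p → sumInsertions x h p ≡ sumInsertions x h' p
    sumInsertions-cong x e p = sumMap-cong e (insertions x p)

    sumPerms-cong : ∀ {h h'} → (∀ q → h q ≡ h' q) → ∀ L → sumPerms h L ≡ sumPerms h' L
    sumPerms-cong e L = sumMap-cong e (perms L)

    sumInsertions-comm : ∀ x y p h → sumInsertions y (sumInsertions x h) p ≡ sumInsertions x (sumInsertions y h) p
    sumInsertions-comm x y [] h = cong (_+ 0) (x∙yz≈y∙xz (h (x ∷ y ∷ [])) (h (y ∷ x ∷ [])) 0)
    sumInsertions-comm x y (z ∷ p) h = begin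
      sumInsertions y (sumInsertions x h) (z ∷ p)  ≡⟨ expand x y ⟩
      h (x ∷ y ∷ z ∷ p) + (h (y ∷ x ∷ z ∷ p) + I x (λ r → h (y ∷ z ∷ r)) p)
        + (I y (λ r → h (x ∷ z ∷ r)) p + I y (I x (h ∘ (z ∷_))) p)
        ≡⟨ cong (λ t → h (x ∷ y ∷ z ∷ p) + (h (y ∷ x ∷ z ∷ p) + I x (λ r → h (y ∷ z ∷ r)) p)
                        + (I y (λ r → h (x ∷ z ∷ r)) p + t)) (sumInsertions-comm x y p (h ∘ (z ∷_))) ⟩
      h (x ∷ y ∷ z ∷ p) + (h (y ∷ x ∷ z ∷ p) + I x (λ r → h (y ∷ z ∷ r)) p)
        + (I y (λ r → h (x ∷ z ∷ r)) p + I x (I y (h ∘ (z ∷_))) p)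
        ≡⟨ rearrange (h (x ∷ y ∷ z ∷ p)) (h (y ∷ x ∷ z ∷ p)) _ _ _ ⟩
      h (y ∷ x ∷ z ∷ p) + (h (x ∷ y ∷ z ∷ p) + I y (λ r → h (x ∷ z ∷ r)) p)
        + (I x (λ r → h (y ∷ z ∷ r)) p + I x (I y (h ∘ (z ∷_))) p)
        ≡⟨ expand y x ⟨
      sumInsertions x (sumInsertions y h) (z ∷ p)  ∎
      where
      I = sumInsertions
      expand : ∀ a b → I b (I a h) (z ∷ p) ≡ h (a ∷ b ∷ z ∷ p) + (h (b ∷ a ∷ z ∷ p) + I a (λ r → h (b ∷ z ∷ r)) p)
                                             + (I b (λ r → h (a ∷ z ∷ r)) p + I b (I a (h ∘ (z ∷_))) p)
      expand a b = begin
        I b (I a h) (z ∷ p)                                 ≡⟨ sumInsertions-∷ b z p (I a h) ⟩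
        I a h (b ∷ z ∷ p) + I b (λ r → I a h (z ∷ r)) p
          ≡⟨ cong₂ _+_ (trans (sumInsertions-∷ a b (z ∷ p) h) (cong (h (a ∷ b ∷ z ∷ p) +_) (sumInsertions-∷ a z p (h ∘ (b ∷_)))))
                       (trans (sumInsertions-cong b (λ r → sumInsertions-∷ a z r h) p) (sumMap-+ _ _ (insertions b p))) ⟩
        _ ∎
      rearrange : ∀ a b c d e → a + (b + c) + (d + e) ≡ b + (a + d) + (c + e)
      rearrange = solve-∀

    sumPerms-↭ : ∀ {L L'} → L ↭ L' → ∀ h → sumPerms h L ≡ sumPerms h L'
    sumPerms-↭ ↭.refl h = refl
    sumPerms-↭ (↭.prep {xs} {ys} x p) h =
      trans (sumPerms-∷ x xs h) (trans (sumPerms-↭ p (sumInsertions x h)) (sym (sumPerms-∷ x ys h)))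
    sumPerms-↭ (↭.swap {xs} {ys} x y p) h = begin
      sumPerms h (x ∷ y ∷ xs)                                   ≡⟨ trans (sumPerms-∷ x (y ∷ xs) h) (sumPerms-∷ y xs _) ⟩
      sumPerms (sumInsertions y (sumInsertions x h)) xs        ≡⟨ sumPerms-↭ p _ ⟩
      sumPerms (sumInsertions y (sumInsertions x h)) ys        ≡⟨ sumPerms-cong (λ q → sumInsertions-comm x y q h) ys ⟩
      sumPerms (sumInsertions x (sumInsertions y h)) ys        ≡⟨ trans (sumPerms-∷ y (x ∷ ys) h) (sumPerms-∷ x ys _) ⟨
      sumPerms h (y ∷ x ∷ ys)                                   ∎
    sumPerms-↭ (↭.trans p q) h = trans (sumPerms-↭ p h) (sumPerms-↭ q h)

    sumInsertions-cong↭ : ∀ x p {h h'} → (∀ q → q ↭ x ∷ p → h q ≡ h' q) → sumInsertions x h p ≡ sumInsertions x h' p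
    sumInsertions-cong↭ x [] e = cong (_+ 0) (e _ ↭-refl)
    sumInsertions-cong↭ x (y ∷ p) {h} {h'} e = begin
      sumInsertions x h (y ∷ p)                  ≡⟨ sumInsertions-∷ x y p h ⟩
      h (x ∷ y ∷ p) + sumInsertions x (h ∘ (y ∷_)) p
        ≡⟨ cong₂ _+_ (e _ ↭-refl) (sumInsertions-cong↭ x p (λ q q↭ → e (y ∷ q) (↭-trans (↭-prep y q↭) (↭-swap y x ↭-refl)))) ⟩
      h' (x ∷ y ∷ p) + sumInsertions x (h' ∘ (y ∷_)) p  ≡⟨ sumInsertions-∷ x y p h' ⟨
      sumInsertions x h' (y ∷ p)                 ∎

    sumPerms-cong↭ : ∀ L {h h'} → (∀ q → q ↭ L → h q ≡ h' q) → sumPerms h L ≡ sumPerms h' L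
    sumPerms-cong↭ [] e = cong (_+ 0) (e [] ↭-refl)
    sumPerms-cong↭ (x ∷ xs) {h} {h'} e = begin
      sumPerms h (x ∷ xs)                  ≡⟨ sumPerms-∷ x xs h ⟩
      sumPerms (sumInsertions x h) xs
        ≡⟨ sumPerms-cong↭ xs (λ p p↭ → sumInsertions-cong↭ x p (λ q q↭ → e q (↭-trans q↭ (↭-prep x p↭)))) ⟩
      sumPerms (sumInsertions x h') xs     ≡⟨ sumPerms-∷ x xs h' ⟨
      sumPerms h' (x ∷ xs)                 ∎

    innerInsertions : A → List A → List (List A)
    innerInsertions x [] = []
    innerInsertions x (y ∷ ys) = (x ∷ y ∷ ys) ∷ map (y ∷_) (innerInsertions x ys)

    sumInsertions-last : ∀ x p h → sumInsertions x h p ≡ h (p ++ [ x ]) + sumMap h (innerInsertions x p)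
    sumInsertions-last x [] h = refl
    sumInsertions-last x (y ∷ ys) h = begin
      sumInsertions x h (y ∷ ys)                                          ≡⟨ sumInsertions-∷ x y ys h ⟩
      h (x ∷ y ∷ ys) + sumInsertions x (h ∘ (y ∷_)) ys                   ≡⟨ cong (h (x ∷ y ∷ ys) +_) (sumInsertions-last x ys (h ∘ (y ∷_))) ⟩
      h (x ∷ y ∷ ys) + (h (y ∷ ys ++ [ x ]) + sumMap (h ∘ (y ∷_)) (innerInsertions x ys))
        ≡⟨ x∙yz≈y∙xz (h (x ∷ y ∷ ys)) (h (y ∷ ys ++ [ x ])) _ ⟩
      h (y ∷ ys ++ [ x ]) + (h (x ∷ y ∷ ys) + sumMap (h ∘ (y ∷_)) (innerInsertions x ys))
        ≡⟨ cong (λ t → h (y ∷ ys ++ [ x ]) + (h (x ∷ y ∷ ys) + t)) (sumMap-map h (y ∷_) (innerInsertions x ys)) ⟨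
      h (y ∷ ys ++ [ x ]) + sumMap h (innerInsertions x (y ∷ ys))         ∎

    innerInsertions-∷ʳ : ∀ x q y → innerInsertions x (q ++ [ y ]) ≡ map (_++ [ y ]) (insertions x q)
    innerInsertions-∷ʳ x [] y = refl
    innerInsertions-∷ʳ x (z ∷ q) y = cong ((x ∷ z ∷ q ++ [ y ]) ∷_) (begin
      map (z ∷_) (innerInsertions x (q ++ [ y ]))      ≡⟨ cong (map (z ∷_)) (innerInsertions-∷ʳ x q y) ⟩
      map (z ∷_) (map (_++ [ y ]) (insertions x q))    ≡⟨ map-∘ (insertions x q) ⟨
      map (λ r → z ∷ r ++ [ y ]) (insertions x q)      ≡⟨ map-∘ (insertions x q) ⟩
      map (_++ [ y ]) (map (z ∷_) (insertions x q))    ∎)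

    picks : List A → List (A × List A)
    picks [] = []
    picks (x ∷ xs) = (x , xs) ∷ map (λ (y , r) → (y , x ∷ r)) (picks xs)

    length-picks : ∀ L → length (picks L) ≡ length L
    length-picks [] = refl
    length-picks (x ∷ xs) = cong suc (trans (length-map _ (picks xs)) (length-picks xs))

    picks-↭ : ∀ L {y r} → (y , r) ∈ picks L → y ∷ r ↭ L
    picks-↭ (x ∷ xs) (here refl) = ↭-refl
    picks-↭ (x ∷ xs) (there m) with ∈-map⁻ (λ (y , r) → (y , x ∷ r)) m
    ... | (y , r) , m′ , refl = ↭-trans (↭-swap y x ↭-refl) (↭-prep x (picks-↭ xs m′))

    picks-unique : ∀ L {y r} → Unique L → (y , r) ∈ picks L → Unique (y ∷ r)
    picks-unique (x ∷ xs) u (here refl) = u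
    picks-unique (x ∷ xs) (x∉xs ∷ u) (there m) with ∈-map⁻ (λ (y , r) → (y , x ∷ r)) m
    ... | (y , r) , m′ , refl with picks-unique xs u m′
    ...   | y∉r ∷ ur = (y≢x ∷ y∉r) ∷ (All.tabulate (λ z∈r → x≢ (there z∈r)) ∷ ur)
      where
      x≢ : ∀ {z} → z ∈ y ∷ r → x ≢ z
      x≢ z∈yr = All.lookup x∉xs (∈-resp-↭ (picks-↭ xs m′) z∈yr)
      y≢x : y ≢ x
      y≢x = x≢ (here refl) ∘ sym

    sumPerms-byLast : ∀ x xs h →
      sumPerms h (x ∷ xs) ≡ sumMap (λ (y , r) → sumPerms (λ p → h (p ++ [ y ])) r) (picks (x ∷ xs))
    sumPerms-byLast x xs h = begin
      sumPerms h (x ∷ xs)                                          ≡⟨ sumPerms-∷ x xs h ⟩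
      sumPerms (sumInsertions x h) xs                              ≡⟨ sumPerms-cong (λ p → sumInsertions-last x p h) xs ⟩
      sumPerms (λ p → h (p ++ [ x ]) + sumMap h (innerInsertions x p)) xs  ≡⟨ sumMap-+ _ _ (perms xs) ⟩
      sumPerms (λ p → h (p ++ [ x ])) xs + sumPerms (sumMap h ∘ innerInsertions x) xs
        ≡⟨ cong (sumPerms (λ p → h (p ++ [ x ])) xs +_) (inner xs) ⟩
      sumPerms (λ p → h (p ++ [ x ])) xs + sumMap (λ (y , r) → sumPerms (λ p → h (p ++ [ y ])) (x ∷ r)) (picks xs)
        ≡⟨ cong (sumPerms (λ p → h (p ++ [ x ])) xs +_) (sumMap-map _ (λ (y , r) → (y , x ∷ r)) (picks xs)) ⟨
      sumMap (λ (y , r) → sumPerms (λ p → h (p ++ [ y ])) r) (picks (x ∷ xs)) ∎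
      where
      inner : ∀ xs → sumPerms (sumMap h ∘ innerInsertions x) xs
                   ≡ sumMap (λ (y , r) → sumPerms (λ p → h (p ++ [ y ])) (x ∷ r)) (picks xs)
      inner [] = refl
      inner (z ∷ zs) = trans (sumPerms-byLast z zs (sumMap h ∘ innerInsertions x))
        (sumMap-cong (λ (y , r) → trans
          (sumPerms-cong (λ p → trans (cong (sumMap h) (innerInsertions-∷ʳ x p y)) (sumMap-map h (_++ [ y ]) (insertions x p))) r)
          (sym (sumPerms-∷ x r (λ p → h (p ++ [ y ])))))
          (picks (z ∷ zs)))

    -- The witness z ∈ L only excludes L = [], whose single ordering has no last element.
    sumPerms-byLast-const : ∀ {z} L h K → z ∈ L →
      (∀ {y r} → (y , r) ∈ picks L → sumPerms (λ p → h (p ++ [ y ])) r ≡ K) → sumPerms h L ≡ length L * K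
    sumPerms-byLast-const (x ∷ xs) h K _ each = begin
      sumPerms h (x ∷ xs)                                                  ≡⟨ sumPerms-byLast x xs h ⟩
      sumMap (λ (y , r) → sumPerms (λ p → h (p ++ [ y ])) r) (picks (x ∷ xs)) ≡⟨ sumMap-cong∈ (picks (x ∷ xs)) each ⟩
      sumMap (λ _ → K) (picks (x ∷ xs))                                   ≡⟨ sumMap-const K (picks (x ∷ xs)) ⟩
      length (picks (x ∷ xs)) * K                                          ≡⟨ cong (_* K) (length-picks (x ∷ xs)) ⟩
      length (x ∷ xs) * K                                                  ∎

    length-byLast : ∀ {z} L {M} → z ∈ L → (∀ {y r} → (y , r) ∈ picks L → length r ≡ M) → length L ≡ suc M
    length-byLast (x ∷ xs) _ each = cong suc (each (here refl))

  sumPerms-map : ∀ {A B : Set} (φ : B → A) L (h : List A → ℕ) → sumPerms h (map φ L) ≡ sumPerms (h ∘ map φ) L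
  sumPerms-map φ [] h = refl
  sumPerms-map φ (x ∷ xs) h = begin
    sumPerms h (φ x ∷ map φ xs)                       ≡⟨ sumPerms-∷ (φ x) (map φ xs) h ⟩
    sumPerms (sumInsertions (φ x) h) (map φ xs)       ≡⟨ sumPerms-map φ xs (sumInsertions (φ x) h) ⟩
    sumPerms (λ p → sumInsertions (φ x) h (map φ p)) xs ≡⟨ sumPerms-cong (λ p → insert-map p h) xs ⟩
    sumPerms (sumInsertions x (h ∘ map φ)) xs         ≡⟨ sumPerms-∷ x xs _ ⟨
    sumPerms (h ∘ map φ) (x ∷ xs)                     ∎
    where
    insert-map : ∀ p h → sumInsertions (φ x) h (map φ p) ≡ sumInsertions x (h ∘ map φ) p
    insert-map [] h = refl
    insert-map (y ∷ p) h = trans (sumInsertions-∷ (φ x) (φ y) (map φ p) h)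
      (trans (cong (h (φ x ∷ φ y ∷ map φ p) +_) (insert-map p (h ∘ (φ y ∷_))))
             (sym (sumInsertions-∷ x y p (h ∘ map φ))))


module Reachability where

  open Booleans
  open import Data.Bool using (Bool; true; false; _∧_; _∨_)
  open import Data.Nat using (zero; suc; _≤_; s≤s)
  open import Data.Nat.Properties using (≤-reflexive; ≤-trans; <-irrefl)
  open import Data.Fin.Properties using (all?; ¬∀⟶∃¬)
  open import Data.List using (List; allFin)
  open import Data.List.Properties using (length-tabulate)
  open import Data.Bool.ListAction using (any)
  open import Data.List.Membership.Propositional using (_∈_)
  open import Data.List.Membership.Propositional.Properties using (∈-allFin)
  open import Data.Product using (_×_; _,_; ∃; proj₁; proj₂)
  open import Data.Sum using (_⊎_; inj₁; inj₂)
  open import Data.Empty using (⊥; ⊥-elim)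
  open import Relation.Nullary using (Dec; yes; no; ¬_)
  open import Function using (_∘_)
  open import Relation.Binary.PropositionalEquality

  module _ {k : ℕ} where
    VertexSet : Set
    VertexSet = Fin k → Bool

    _⊆_ : VertexSet → VertexSet → Set
    S ⊆ C = ∀ w → S w ≡ true → C w ≡ true

    Closed : List (Edge k) → VertexSet → Set
    Closed F C = ∀ {x y} → (x , y) ∈ F → (C x ≡ true → C y ≡ true) × (C y ≡ true → C x ≡ true)

    stepsTo : VertexSet → Fin k → Edge k → Bool
    stepsTo S w (a , b) = (S a ∧ (w == b)) ∨ (S b ∧ (w == a))

    step-stepsTo : ∀ F S w → step F S w ≡ S w ∨ any (stepsTo S w) F
    step-stepsTo F S w = cong (S w ∨_) (any-cong (λ { (a , b) → refl }) F)

    touches : Fin k → Edge k → Bool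
    touches w (a , b) = (w == a) ∨ (w == b)

    incident-touches : ∀ F w → incident F w ≡ any (touches w) F
    incident-touches F w = any-cong (λ { (a , b) → refl }) F

    step-true⁻ : ∀ F S w → step F S w ≡ true →
      S w ≡ true ⊎ ∃ λ x → ∃ λ y → (x , y) ∈ F × ((S x ≡ true × w ≡ y) ⊎ (S y ≡ true × w ≡ x))
    step-true⁻ F S w e with ∨-true⁻ (S w) _ (trans (sym (step-stepsTo F S w)) e)
    ... | inj₁ Sw = inj₁ Sw
    ... | inj₂ r with any-true⁻ (stepsTo S w) F r
    ... | (x , y) , m , xy with ∨-true⁻ (S x ∧ (w == y)) (S y ∧ (w == x)) xy
    ... | inj₁ q = let (Sx , w=y) = ∧-true⁻ (S x) _ q in inj₂ (x , y , m , inj₁ (Sx , ==⇒≡ {a = w} w=y))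
    ... | inj₂ q = let (Sy , w=x) = ∧-true⁻ (S y) _ q in inj₂ (x , y , m , inj₂ (Sy , ==⇒≡ {a = w} w=x))

    step-keeps : ∀ F S w → S w ≡ true → step F S w ≡ true
    step-keeps F S w Sw = trans (step-stepsTo F S w) (∨-true⁺ˡ _ Sw)

    step-extendsʳ : ∀ F S {x y} → (x , y) ∈ F → S x ≡ true → step F S y ≡ true
    step-extendsʳ F S {x} {y} m Sx = trans (step-stepsTo F S y)
      (∨-true⁺ʳ (S y) (any-true⁺ (stepsTo S y) m (∨-true⁺ˡ _ (cong₂ _∧_ Sx (==-refl y)))))

    step-extendsˡ : ∀ F S {x y} → (x , y) ∈ F → S y ≡ true → step F S x ≡ true
    step-extendsˡ F S {x} {y} m Sy = trans (step-stepsTo F S x)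
      (∨-true⁺ʳ (S x) (any-true⁺ (stepsTo S x) m (∨-true⁺ʳ (S x ∧ (x == y)) (cong₂ _∧_ Sy (==-refl x)))))

    step-mono : ∀ F {S C} → S ⊆ C → step F S ⊆ step F C
    step-mono F {S} {C} S⊆C w e with step-true⁻ F S w e
    ... | inj₁ Sw = step-keeps F C w (S⊆C w Sw)
    ... | inj₂ (x , y , m , inj₁ (Sx , refl)) = step-extendsʳ F C m (S⊆C x Sx)
    ... | inj₂ (x , y , m , inj₂ (Sy , refl)) = step-extendsˡ F C m (S⊆C y Sy)

    Closed⇒step⊆ : ∀ F {C} → Closed F C → step F C ⊆ C
    Closed⇒step⊆ F {C} cl w e with step-true⁻ F C w e
    ... | inj₁ Cw = Cw
    ... | inj₂ (x , y , m , inj₁ (Cx , refl)) = proj₁ (cl m) Cx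
    ... | inj₂ (x , y , m , inj₂ (Cy , refl)) = proj₂ (cl m) Cy

    step⊆⇒Closed : ∀ F {C} → step F C ⊆ C → Closed F C
    step⊆⇒Closed F {C} h {x} {y} m = (λ Cx → h y (step-extendsʳ F C m Cx)) , (λ Cy → h x (step-extendsˡ F C m Cy))

    reachableWithin : List (Edge k) → Fin k → ℕ → VertexSet
    reachableWithin F v t = iter t (step F) (_== v)

    reachableWithin⊆Closed : ∀ F {C} v → Closed F C → C v ≡ true → ∀ t → reachableWithin F v t ⊆ C
    reachableWithin⊆Closed F {C} v cl Cv zero w w=v = subst (λ z → C z ≡ true) (sym (==⇒≡ {a = w} w=v)) Cv
    reachableWithin⊆Closed F {C} v cl Cv (suc t) =
      λ w e → Closed⇒step⊆ F cl w (step-mono F (reachableWithin⊆Closed F v cl Cv t) w e)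

    reachableWithin-suc : ∀ F v t → reachableWithin F v t ⊆ reachableWithin F v (suc t)
    reachableWithin-suc F v t = step-keeps F (reachableWithin F v t)

    size : VertexSet → ℕ
    size S = countᵇ S (allFin k)

    private
      implies? : ∀ a b → Dec (a ≡ true → b ≡ true)
      implies? a true = yes (λ _ → refl)
      implies? true false = no (λ h → true≢false (sym (h refl)))
      implies? false false = yes (λ e → e)

      ¬implies : ∀ {a b} → ¬ (a ≡ true → b ≡ true) → a ≡ true × b ≡ false
      ¬implies {a} {true} h = ⊥-elim (h (λ _ → refl))
      ¬implies {true} {false} h = refl , refl
      ¬implies {false} {false} h = ⊥-elim (h (λ e → e))

    ⊆? : ∀ S C → Dec (S ⊆ C)
    ⊆? S C = all? (λ w → implies? (S w) (C w))

    ¬⊆⇒witness : ∀ {S C} → ¬ S ⊆ C → ∃ λ w → S w ≡ true × C w ≡ false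
    ¬⊆⇒witness {S} {C} S⊈C = let (w , h) = ¬∀⟶∃¬ k _ (λ w → implies? (S w) (C w)) S⊈C in w , ¬implies h

    -- Until the iterates become closed every step adds a vertex, and there are only k vertices.
    reachableWithin-grows : ∀ F v t →
      step F (reachableWithin F v t) ⊆ reachableWithin F v t ⊎ suc t ≤ size (reachableWithin F v t)
    reachableWithin-grows F v zero = inj₂ (count-pos _ (∈-allFin v) (==-refl v))
    reachableWithin-grows F v (suc t) with ⊆? (step F (reachableWithin F v t)) (reachableWithin F v t)
                                         | reachableWithin-grows F v t
    ... | yes closed | _ = inj₁ (λ w e → reachableWithin-suc F v t w (closed w (step-mono F closed w e)))
    ... | no ¬closed | inj₁ closed = ⊥-elim (¬closed closed)
    ... | no ¬closed | inj₂ big = let (w , new , old) = ¬⊆⇒witness ¬closed in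
      inj₂ (≤-trans (s≤s big) (count-mono-< (reachableWithin-suc F v t) (∈-allFin w) new old))

    reachable-Closed : ∀ F v → Closed F (reachable F v)
    reachable-Closed F v with reachableWithin-grows F v k
    ... | inj₁ closed = step⊆⇒Closed F closed
    ... | inj₂ big = ⊥-elim (<-irrefl refl
      (≤-trans big (≤-trans (count-le (reachable F v) (allFin k)) (≤-reflexive (length-tabulate {n = k} (λ i → i))))))

    reachable-refl : ∀ F v → reachable F v v ≡ true
    reachable-refl F v = within k
      where
      within : ∀ t → reachableWithin F v t v ≡ true
      within zero = ==-refl v
      within (suc t) = reachableWithin-suc F v t v (within t)

    reachable⊆Closed : ∀ F {C} v → Closed F C → C v ≡ true → reachable F v ⊆ C
    reachable⊆Closed F v cl Cv = reachableWithin⊆Closed F v cl Cv k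

    reachable-trans : ∀ F {v x y} → reachable F v x ≡ true → reachable F x y ≡ true → reachable F v y ≡ true
    reachable-trans F {v} {x} {y} vx xy = reachable⊆Closed F x (reachable-Closed F v) vx y xy

    reachable-sym : ∀ F {v x} → reachable F v x ≡ true → reachable F x v ≡ true
    reachable-sym F {v} {x} vx = reachable⊆Closed F {λ z → reachable F z v} v cl (reachable-refl F v) x vx
      where
      cl : Closed F (λ z → reachable F z v)
      cl {p} {q} m = (λ pv → reachable-trans F (proj₂ (reachable-Closed F q m) (reachable-refl F q)) pv)
                   , (λ qv → reachable-trans F (proj₁ (reachable-Closed F p m) (reachable-refl F p)) qv)

    reachable-mono : ∀ {F F′} v → (∀ {e} → e ∈ F → e ∈ F′) → reachable F v ⊆ reachable F′ v
    reachable-mono {F = F} {F′ = F′} v F⊆F′ = reachable⊆Closed F v (reachable-Closed F′ v ∘ F⊆F′) (reachable-refl F′ v)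

    incident-fst : ∀ F {x y} → (x , y) ∈ F → incident F x ≡ true
    incident-fst F {x} {y} m = trans (incident-touches F x) (any-true⁺ (touches x) m (∨-true⁺ˡ (x == y) (==-refl x)))

    incident-snd : ∀ F {x y} → (x , y) ∈ F → incident F y ≡ true
    incident-snd F {x} {y} m = trans (incident-touches F y) (any-true⁺ (touches y) m (∨-true⁺ʳ (y == x) (==-refl y)))

    reachable⇒incident : ∀ F {v w} → reachable F v w ≡ true → w ≡ v ⊎ incident F w ≡ true
    reachable⇒incident F {v} {w} vw with ∨-true⁻ (w == v) (incident F w)
        (reachable⊆Closed F {λ z → (z == v) ∨ incident F z} v cl (∨-true⁺ˡ (incident F v) (==-refl v)) w vw)
      where
      cl : Closed F (λ z → (z == v) ∨ incident F z)
      cl {x} {y} m = (λ _ → ∨-true⁺ʳ (y == v) (incident-snd F m)) , (λ _ → ∨-true⁺ʳ (x == v) (incident-fst F m))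
    ... | inj₁ w=v = inj₁ (==⇒≡ {a = w} w=v)
    ... | inj₂ w-inc = inj₂ w-inc

    reachable-from-isolated : ∀ F {a w} → incident F a ≡ false → reachable F a w ≡ true → w ≡ a
    reachable-from-isolated F {a} {w} a-iso aw = ==⇒≡ {a = w} (reachable⊆Closed F {_== a} a cl (==-refl a) w aw)
      where
      not-a : ∀ {z} → incident F z ≡ true → (z == a) ≡ true → ⊥
      not-a {z} z-inc z=a = true≢false (trans (sym (subst (λ t → incident F t ≡ true) (==⇒≡ {a = z} z=a) z-inc)) a-iso)
      cl : Closed F (_== a)
      cl {x} {y} m = (λ x=a → ⊥-elim (not-a {x} (incident-fst F m) x=a)) , (λ y=a → ⊥-elim (not-a {y} (incident-snd F m) y=a))


module Components where

  open Booleans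
  open Reachability
  open import Data.Bool using (Bool; true; false; _∧_; _∨_; not; _≟_)
  open import Data.Bool.Properties using (∧-zeroʳ; ∧-identityʳ)
  open import Data.Nat using (zero; suc; _+_; _<_; _<ᵇ_; s≤s; _<?_)
  open import Data.Nat.Properties using (≤-refl; <-cmp; <-≤-trans; +-comm)
  open import Data.Fin using (zero; suc; toℕ)
  open import Data.Fin.Properties using (toℕ-injective; any?)
  open import Data.List using (List; []; _∷_; allFin; tabulate)
  open import Data.Bool.ListAction using (all)
  open import Data.List.Membership.Propositional.Properties using (∈-allFin)
  open import Data.List.Relation.Unary.Any using (here; there)
  open import Data.Product using (_×_; _,_; ∃; proj₁; proj₂)
  open import Data.Sum using (_⊎_; inj₁; inj₂; [_,_])
  open import Data.Empty using (⊥; ⊥-elim)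
  open import Relation.Nullary using (yes; no)
  open import Relation.Nullary.Decidable using (_×-dec_)
  open import Relation.Binary.Definitions using (tri<; tri≈; tri>)
  open import Relation.Binary.PropositionalEquality hiding ([_])

  count-tabulate-cong : ∀ {A B : Set} n (f : Fin n → A) (g : Fin n → B) (p : A → Bool) (q : B → Bool) →
    (∀ i → p (f i) ≡ q (g i)) → countᵇ p (tabulate f) ≡ countᵇ q (tabulate g)
  count-tabulate-cong zero f g p q e = refl
  count-tabulate-cong (suc n) f g p q e = begin
    countᵇ p (tabulate f)                                      ≡⟨ count-cons p (f zero) (tabulate (λ i → f (suc i))) ⟩
    χ (p (f zero)) + countᵇ p (tabulate (λ i → f (suc i)))
      ≡⟨ cong₂ _+_ (cong χ (e zero)) (count-tabulate-cong n _ _ p q (λ i → e (suc i))) ⟩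
    χ (q (g zero)) + countᵇ q (tabulate (λ i → g (suc i)))     ≡⟨ count-cons q (g zero) (tabulate (λ i → g (suc i))) ⟨
    countᵇ q (tabulate g)                                      ∎
    where open ≡-Reasoning

  count-false : ∀ {A : Set} (xs : List A) → countᵇ (λ _ → false) xs ≡ 0
  count-false [] = refl
  count-false (x ∷ xs) = count-false xs

  count-== : ∀ n (m : Fin n) → countᵇ (_== m) (allFin n) ≡ 1
  count-== (suc n) zero = cong suc (trans (count-tabulate-cong n suc (λ i → i) (_== zero) (λ _ → false) (λ i → refl))
                                          (count-false (allFin n)))
  count-== (suc n) (suc m) = trans (count-tabulate-cong n suc (λ i → i) (_== suc m) (_== m) (λ i → refl)) (count-== n m)

  module _ {k : ℕ} where
    noSmallerIn : (Fin k → Bool) → Fin k → Bool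
    noSmallerIn D v = all (λ w → not ((toℕ w <ᵇ toℕ v) ∧ D w)) (allFin k)

    noSmallerIn-cong : ∀ {D D′} → (∀ w → D w ≡ D′ w) → ∀ v → noSmallerIn D v ≡ noSmallerIn D′ v
    noSmallerIn-cong D=D′ v = all-cong (λ w → cong (λ d → not ((toℕ w <ᵇ toℕ v) ∧ d)) (D=D′ w)) (allFin k)

    isLeastIn : (Fin k → Bool) → Fin k → Bool
    isLeastIn D v = D v ∧ noSmallerIn D v

    least-exists : ∀ (D : Fin k → Bool) bound a → toℕ a < bound → D a ≡ true →
      ∃ λ m → D m ≡ true × (∀ w → toℕ w < toℕ m → D w ≡ false)
    least-exists D (suc bound) a (s≤s a<bound) Da
      with any? (λ w → (toℕ w <? toℕ a) ×-dec (D w ≟ true))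
    ... | yes (w , w<a , Dw) = least-exists D bound w (<-≤-trans w<a a<bound) Dw
    ... | no ∄smaller = a , Da , (λ w w<a → ¬true⇒false (λ Dw → ∄smaller (w , w<a , Dw)))

    isLeastIn-unique : ∀ D m → D m ≡ true → (∀ w → toℕ w < toℕ m → D w ≡ false) → ∀ v → isLeastIn D v ≡ (v == m)
    isLeastIn-unique D m Dm least v = bool-ext ⇒m m⇒
      where
      ⇒m : isLeastIn D v ≡ true → (v == m) ≡ true
      ⇒m e with ∧-true⁻ (D v) _ e | <-cmp (toℕ v) (toℕ m)
      ... | Dv , _ | tri< v<m _ _ = ⊥-elim (true≢false (trans (sym Dv) (least v v<m)))
      ... | _ | tri≈ _ v=m _ = ≡⇒== {a = v} (toℕ-injective v=m)
      ... | _ , none | tri> _ _ m<v = ⊥-elim (true≢false (trans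
            (sym (all-true⁻ (λ w → not ((toℕ w <ᵇ toℕ v) ∧ D w)) none (∈-allFin m)))
            (cong₂ (λ x y → not (x ∧ y)) (<⇒<ᵇ-true m<v) Dm)))
      none-below-m : ∀ w → not ((toℕ w <ᵇ toℕ m) ∧ D w) ≡ true
      none-below-m w with toℕ w <ᵇ toℕ m in w<m
      ... | false = refl
      ... | true rewrite least w (<ᵇ-true⇒< w<m) = refl
      m⇒ : (v == m) ≡ true → isLeastIn D v ≡ true
      m⇒ e rewrite ==⇒≡ {a = v} e | Dm = all-true⁺ _ (allFin k) (λ w _ → none-below-m w)

    count-isLeastIn : ∀ D a → D a ≡ true → countᵇ (isLeastIn D) (allFin k) ≡ 1
    count-isLeastIn D a Da with least-exists D (suc (toℕ a)) a ≤-refl Da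
    ... | m , Dm , least = trans (count-cong (isLeastIn-unique D m Dm least) (allFin k)) (count-== k m)

    -- components X is, by definition, countᵇ (isRoot X) (allFin k): each component is counted at its least vertex.
    isRoot : List (Edge k) → Fin k → Bool
    isRoot X v = incident X v ∧ noSmallerIn (reachable X v) v

    isRoot-cong : ∀ X Y v → incident X v ≡ incident Y v → (∀ w → reachable X v w ≡ reachable Y v w) →
      isRoot X v ≡ isRoot Y v
    isRoot-cong X Y v inc reach = cong₂ _∧_ inc (noSmallerIn-cong reach v)

    isRoot∧reachable : ∀ X a → incident X a ≡ true → ∀ v → isRoot X v ∧ reachable X a v ≡ isLeastIn (reachable X a) v
    isRoot∧reachable X a a-inc v with reachable X a v in av
    ... | false = ∧-zeroʳ (isRoot X v)
    ... | true = trans (∧-identityʳ (isRoot X v)) (cong₂ _∧_ (v-inc (reachable⇒incident X av)) (noSmallerIn-cong same-component v))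
      where
      v-inc : v ≡ a ⊎ incident X v ≡ true → incident X v ≡ true
      v-inc (inj₁ refl) = a-inc
      v-inc (inj₂ inc) = inc
      same-component : ∀ w → reachable X v w ≡ reachable X a w
      same-component w = bool-ext (reachable-trans X av) (reachable-trans X (reachable-sym X av))

    count-roots-reachable : ∀ X a → countᵇ (λ v → isRoot X v ∧ reachable X a v) (allFin k) ≡ χ (incident X a)
    count-roots-reachable X a with incident X a in a-inc
    ... | true = trans (count-cong (isRoot∧reachable X a a-inc) (allFin k)) (count-isLeastIn _ a (reachable-refl X a))
    ... | false = trans (count-cong not-root (allFin k)) (count-false (allFin k))
      where
      not-root : ∀ v → isRoot X v ∧ reachable X a v ≡ false
      not-root v with reachable X a v in av
      ... | false = ∧-zeroʳ (isRoot X v)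
      ... | true rewrite reachable-from-isolated X a-inc av | a-inc = refl

    module _ (F : List (Edge k)) (a b : Fin k) (b-iso : incident F b ≡ false) where
      private
        F′ = (a , b) ∷ F
        D = reachable F′ a

      reachable-pendant⁻ : ∀ v → reachable F′ a v ≡ true → reachable F a v ≡ true ⊎ v ≡ b
      reachable-pendant⁻ v av with ∨-true⁻ (reachable F a v) (v == b)
          (reachable⊆Closed F′ {D₀} a closed (∨-true⁺ˡ (a == b) (reachable-refl F a)) v av)
        where
        D₀ : Fin k → Bool
        D₀ w = reachable F a w ∨ (w == b)
        not-b : ∀ {z} → incident F z ≡ true → (z == b) ≡ true → ⊥
        not-b {z} z-inc z=b = true≢false (trans (sym (subst (λ t → incident F t ≡ true) (==⇒≡ {a = z} z=b) z-inc)) b-iso)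
        closed : Closed F′ D₀
        closed (here refl) = (λ _ → ∨-true⁺ʳ (reachable F a b) (==-refl b)) , (λ _ → ∨-true⁺ˡ (a == b) (reachable-refl F a))
        closed {x} {y} (there m) = x⇒y , y⇒x
          where
          x⇒y : D₀ x ≡ true → D₀ y ≡ true
          x⇒y e with ∨-true⁻ (reachable F a x) (x == b) e
          ... | inj₁ ax = ∨-true⁺ˡ (y == b) (proj₁ (reachable-Closed F a m) ax)
          ... | inj₂ x=b = ⊥-elim (not-b {x} (incident-fst F m) x=b)
          y⇒x : D₀ y ≡ true → D₀ x ≡ true
          y⇒x e with ∨-true⁻ (reachable F a y) (y == b) e
          ... | inj₁ ay = ∨-true⁺ˡ (x == b) (proj₂ (reachable-Closed F a m) ay)
          ... | inj₂ y=b = ⊥-elim (not-b {y} (incident-snd F m) y=b)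
      ... | inj₁ av′ = inj₁ av′
      ... | inj₂ v=b = inj₂ (==⇒≡ {a = v} v=b)

      D-a : D a ≡ true
      D-a = reachable-refl F′ a

      D-b : D b ≡ true
      D-b = proj₁ (reachable-Closed F′ a (here refl)) D-a

      isRoot-pendant-outside : ∀ v → D v ≡ false → isRoot F′ v ≡ isRoot F v
      isRoot-pendant-outside v v∉D = isRoot-cong F′ F v same-incidence same-reach
        where
        ∉D : ∀ {z} → D z ≡ true → v ≢ z
        ∉D Dz refl = true≢false (trans (sym Dz) v∉D)
        same-incidence : incident F′ v ≡ incident F v
        same-incidence rewrite ≢⇒== (∉D D-a) | ≢⇒== (∉D D-b) = refl
        a-unreachable : reachable F v a ≡ false
        a-unreachable = ¬true⇒false (λ va → ∉D (reachable-mono {F = F} {F′ = F′} a there v (reachable-sym F va)) refl)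
        b-unreachable : reachable F v b ≡ false
        b-unreachable = ¬true⇒false (λ vb → [ (λ b=v → ∉D D-b (sym b=v)) , (λ b-inc → true≢false (trans (sym b-inc) b-iso)) ]
                                             (reachable⇒incident F vb))
        closed : Closed F′ (reachable F v)
        closed (here refl) = (λ va → ⊥-elim (true≢false (trans (sym va) a-unreachable)))
                           , (λ vb → ⊥-elim (true≢false (trans (sym vb) b-unreachable)))
        closed (there m) = reachable-Closed F v m
        same-reach : ∀ w → reachable F′ v w ≡ reachable F v w
        same-reach w = bool-ext (reachable⊆Closed F′ v closed (reachable-refl F v) w) (reachable-mono {F = F} {F′ = F′} v there w)

      isRoot∧reachable-pendant : ∀ v → isRoot F v ∧ D v ≡ isRoot F v ∧ reachable F a v
      isRoot∧reachable-pendant v with D v in Dv | reachable F a v in av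
      ... | false | false = refl
      ... | false | true = ⊥-elim (true≢false (trans (sym (reachable-mono {F = F} {F′ = F′} a there v av)) Dv))
      ... | true | true = refl
      ... | true | false with reachable-pendant⁻ v Dv
      ...   | inj₁ av′ = ⊥-elim (true≢false (trans (sym av′) av))
      ...   | inj₂ refl rewrite b-iso = refl

      -- The new edge merges b into the component of a; it creates a new component exactly when a was isolated.
      components-pendant : components F′ + χ (incident F a) ≡ suc (components F)
      components-pendant = begin
        components F′ + χ (incident F a)  ≡⟨ cong (_+ χ (incident F a)) components-F′ ⟩
        suc outside + χ (incident F a)    ≡⟨ cong suc (+-comm outside _) ⟩
        suc (χ (incident F a) + outside)  ≡⟨ cong suc components-F ⟨
        suc (components F)                ∎
        where
        open ≡-Reasoning
        outside : ℕ
        outside = countᵇ (λ v → isRoot F v ∧ not (D v)) (allFin k)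
        same-outside : ∀ v → isRoot F′ v ∧ not (D v) ≡ isRoot F v ∧ not (D v)
        same-outside v with D v in Dv
        ... | true = trans (∧-zeroʳ (isRoot F′ v)) (sym (∧-zeroʳ (isRoot F v)))
        ... | false = cong (_∧ true) (isRoot-pendant-outside v Dv)
        components-F′ : components F′ ≡ suc outside
        components-F′ = trans (count-split (isRoot F′) D (allFin k))
          (cong₂ _+_ (trans (count-roots-reachable F′ a) (cong χ (incident-fst F′ (here refl))))
                     (count-cong same-outside (allFin k)))
        components-F : components F ≡ χ (incident F a) + outside
        components-F = trans (count-split (isRoot F) D (allFin k))
          (cong (_+ outside) (trans (count-cong isRoot∧reachable-pendant (allFin k)) (count-roots-reachable F a)))


module Orientation where

  open Booleans using (==⇒≡; ==-refl; ∨-true⁻; ∧-true⁻; ∨-true⁺ʳ; <ᵇ-true⇒<; <⇒<ᵇ-true; true≢false)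
  open import Data.Bool using (Bool; true; false; _∧_; _∨_; if_then_else_)
  open import Data.Nat using (_<_; _<ᵇ_)
  open import Data.Nat.Properties using (<-asym; <-cmp)
  open import Data.Fin using (toℕ)
  open import Data.Fin.Properties using (toℕ-injective)
  open import Data.Product using (_×_; _,_)
  open import Data.Sum using (_⊎_; inj₁; inj₂)
  open import Data.Empty using (⊥-elim)
  open import Relation.Binary.Definitions using (tri<; tri≈; tri>)
  open import Relation.Binary.PropositionalEquality

  module _ {k : ℕ} where
    SameEdge : Edge k → Edge k → Set
    SameEdge (a , b) (c , d) = (a ≡ c × b ≡ d) ⊎ (a ≡ d × b ≡ c)

    SameEdge-refl : ∀ {x} → SameEdge x x
    SameEdge-refl = inj₁ (refl , refl)

    SameEdge-sym : ∀ {x y} → SameEdge x y → SameEdge y x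
    SameEdge-sym (inj₁ (refl , refl)) = inj₁ (refl , refl)
    SameEdge-sym (inj₂ (refl , refl)) = inj₂ (refl , refl)

    SameEdge-trans : ∀ {x y z} → SameEdge x y → SameEdge y z → SameEdge x z
    SameEdge-trans (inj₁ (refl , refl)) s = s
    SameEdge-trans (inj₂ (refl , refl)) (inj₁ (refl , refl)) = inj₂ (refl , refl)
    SameEdge-trans (inj₂ (refl , refl)) (inj₂ (refl , refl)) = inj₁ (refl , refl)

    ≡⇒SameEdge : ∀ {x y} → x ≡ y → SameEdge x y
    ≡⇒SameEdge refl = SameEdge-refl

    sameEdgeᵇ : Edge k → Edge k → Bool
    sameEdgeᵇ (i , j) (u , v) = ((i == u) ∧ (j == v)) ∨ ((i == v) ∧ (j == u))

    sameEdgeᵇ-true⁻ : ∀ x y → sameEdgeᵇ x y ≡ true → SameEdge x y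
    sameEdgeᵇ-true⁻ (i , j) (u , v) e with ∨-true⁻ ((i == u) ∧ (j == v)) _ e
    ... | inj₁ q = let (i=u , j=v) = ∧-true⁻ (i == u) _ q in inj₁ (==⇒≡ {a = i} i=u , ==⇒≡ {a = j} j=v)
    ... | inj₂ q = let (i=v , j=u) = ∧-true⁻ (i == v) _ q in inj₂ (==⇒≡ {a = i} i=v , ==⇒≡ {a = j} j=u)

    sameEdgeᵇ-true⁺ : ∀ x y → SameEdge x y → sameEdgeᵇ x y ≡ true
    sameEdgeᵇ-true⁺ (i , j) (u , v) (inj₁ (refl , refl)) rewrite ==-refl i | ==-refl j = refl
    sameEdgeᵇ-true⁺ (i , j) (u , v) (inj₂ (refl , refl)) rewrite ==-refl i | ==-refl j = ∨-true⁺ʳ ((i == j) ∧ (j == i)) refl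

    Ordered : Edge k → Set
    Ordered (a , b) = toℕ a < toℕ b

    SameEdge-Ordered⇒≡ : ∀ {x y} → Ordered x → Ordered y → SameEdge x y → x ≡ y
    SameEdge-Ordered⇒≡ _ _ (inj₁ (refl , refl)) = refl
    SameEdge-Ordered⇒≡ x< y< (inj₂ (refl , refl)) = ⊥-elim (<-asym x< y<)

    orient : Edge k → Edge k
    orient (a , b) = if toℕ a <ᵇ toℕ b then (a , b) else (b , a)

    orient-cases : ∀ a b → orient (a , b) ≡ (a , b) ⊎ orient (a , b) ≡ (b , a)
    orient-cases a b with toℕ a <ᵇ toℕ b
    ... | true = inj₁ refl
    ... | false = inj₂ refl

    orient-SameEdge : ∀ x → SameEdge (orient x) x
    orient-SameEdge (a , b) with orient-cases a b
    ... | inj₁ e rewrite e = inj₁ (refl , refl)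
    ... | inj₂ e rewrite e = inj₂ (refl , refl)

    orient≡⇒SameEdge : ∀ {x y} → orient x ≡ y → SameEdge x y
    orient≡⇒SameEdge {x} refl = SameEdge-sym (orient-SameEdge x)

    orient-Ordered : ∀ a b → a ≢ b → Ordered (orient (a , b))
    orient-Ordered a b a≢b with toℕ a <ᵇ toℕ b in a<b
    ... | true = <ᵇ-true⇒< a<b
    ... | false with <-cmp (toℕ a) (toℕ b)
    ...   | tri< a<b′ _ _ = ⊥-elim (true≢false (trans (sym (<⇒<ᵇ-true a<b′)) a<b))
    ...   | tri≈ _ a=b _ = ⊥-elim (a≢b (toℕ-injective a=b))
    ...   | tri> _ _ b<a = b<a


module Process where

  open Booleans
  open Reachability
  open Components
  open Orientation using (SameEdge; orient; orient-cases; orient-SameEdge)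
  open import Data.Bool using (Bool; true; false; _∧_; _∨_; not)
  open import Data.Bool.Properties using (∨-comm; ∨-assoc; ∨-identityʳ)
  open import Data.Nat using (zero; suc; _+_)
  open import Data.Nat.Properties using (+-cancelʳ-≡; +-comm; suc-injective)
  open import Data.List using (List; []; _∷_; _++_; [_]; map; allFin)
  open import Data.List.Properties using (++-identityʳ)
  open import Data.Bool.ListAction using (any)
  open import Data.Product using (_×_; _,_; proj₁; proj₂)
  open import Data.Sum using (_⊎_; inj₁; inj₂)
  import Data.Sum
  open import Relation.Binary.PropositionalEquality hiding ([_])
  open ≡-Reasoning

  module _ {A : Set} where
    any-++ : ∀ (p : A → Bool) xs ys → any p (xs ++ ys) ≡ any p xs ∨ any p ys
    any-++ p [] ys = refl
    any-++ p (x ∷ xs) ys = trans (cong (p x ∨_) (any-++ p xs ys)) (sym (∨-assoc (p x) (any p xs) (any p ys)))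

    any-map : ∀ {B : Set} (p : B → Bool) (f : A → B) xs → any p (map f xs) ≡ any (λ e → p (f e)) xs
    any-map p f [] = refl
    any-map p f (x ∷ xs) = cong (p (f x) ∨_) (any-map p f xs)

    any-∷-++ : ∀ (p : A → Bool) e xs ys → any p (e ∷ xs ++ ys) ≡ any p (xs ++ e ∷ ys)
    any-∷-++ p e xs ys = begin
      p e ∨ any p (xs ++ ys)          ≡⟨ cong (p e ∨_) (any-++ p xs ys) ⟩
      p e ∨ (any p xs ∨ any p ys)     ≡⟨ ∨-assoc (p e) (any p xs) (any p ys) ⟨
      (p e ∨ any p xs) ∨ any p ys     ≡⟨ cong (_∨ any p ys) (∨-comm (p e) (any p xs)) ⟩
      (any p xs ∨ p e) ∨ any p ys     ≡⟨ ∨-assoc (any p xs) (p e) (any p ys) ⟩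
      any p xs ∨ (p e ∨ any p ys)     ≡⟨ any-++ p xs (e ∷ ys) ⟨
      any p (xs ++ e ∷ ys)            ∎

  module _ {k : ℕ} where
    Unoriented : (Edge k → Bool) → Set
    Unoriented p = ∀ a b → p (a , b) ≡ p (b , a)

    -- F ≈ G: the same undirected edges occur in F and G (order, orientation and multiplicity are ignored).
    _≈_ : List (Edge k) → List (Edge k) → Set
    F ≈ G = ∀ p → Unoriented p → any p F ≡ any p G

    ≈-flip : ∀ a b F → ((a , b) ∷ F) ≈ ((b , a) ∷ F)
    ≈-flip a b F p unoriented = cong (_∨ any p F) (unoriented a b)

    reachableWithin-≈ : ∀ F G → F ≈ G → ∀ v t w → reachableWithin F v t w ≡ reachableWithin G v t w
    reachableWithin-≈ F G F≈G v zero w = refl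
    reachableWithin-≈ F G F≈G v (suc t) w = begin
      step F (S F) w                               ≡⟨ step-stepsTo F (S F) w ⟩
      S F w ∨ any (stepsTo (S F) w) F              ≡⟨ cong₂ _∨_ (IH w) (F≈G _ unoriented) ⟩
      S G w ∨ any (stepsTo (S F) w) G
        ≡⟨ cong (S G w ∨_) (any-cong (λ (a , b) → cong₂ _∨_ (cong (_∧ (w == b)) (IH a)) (cong (_∧ (w == a)) (IH b))) G) ⟩
      S G w ∨ any (stepsTo (S G) w) G              ≡⟨ step-stepsTo G (S G) w ⟨
      step G (S G) w                               ∎
      where
      S : List (Edge k) → VertexSet
      S X = reachableWithin X v t
      IH : ∀ u → S F u ≡ S G u
      IH = reachableWithin-≈ F G F≈G v t
      unoriented : Unoriented (stepsTo (S F) w)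
      unoriented a b = ∨-comm (S F a ∧ (w == b)) (S F b ∧ (w == a))

    components-≈ : ∀ F G → F ≈ G → components F ≡ components G
    components-≈ F G F≈G = count-cong (λ v → isRoot-cong F G v (same-incidence v) (reachableWithin-≈ F G F≈G v k))
                                      (allFin k)
      where
      same-incidence : ∀ v → incident F v ≡ incident G v
      same-incidence v = begin
        incident F v        ≡⟨ incident-touches F v ⟩
        any (touches v) F   ≡⟨ F≈G (touches v) (λ a b → ∨-comm (v == a) (v == b)) ⟩
        any (touches v) G   ≡⟨ incident-touches G v ⟨
        incident G v        ∎

    Fresh : List (Edge k) → Edge k → Set
    Fresh F (a , b) = incident F b ≡ false ⊎ incident F a ≡ false

    data Grown : List (Edge k) → Set where
      []  : Grown []
      _∷_ : ∀ {e F} → Fresh F e → Grown F → Grown (e ∷ F)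

    components-fresh : ∀ F a b → Fresh F (a , b) →
      components ((a , b) ∷ F) + χ (incident F a ∨ incident F b) ≡ suc (components F)
    components-fresh F a b (inj₁ b-iso) rewrite b-iso | ∨-identityʳ (incident F a) = components-pendant F a b b-iso
    components-fresh F a b (inj₂ a-iso) rewrite a-iso =
      trans (cong (_+ χ (incident F b)) (components-≈ ((a , b) ∷ F) ((b , a) ∷ F) (≈-flip a b F))) (components-pendant F b a a-iso)

    keep : Bool → Edge k → List (Edge k) → List (Edge k)
    keep true e acc = e ∷ acc
    keep false e acc = acc

    cover : (Fin k → Bool) → Fin k → Fin k → Fin k → Bool
    cover cov u v w = cov w ∨ (w == u) ∨ (w == v)

    -- process with the kept edges accumulated in reverse order, so that every edge is fresh for the ones below it.
    processAcc : (Fin k → Bool) → List (Edge k) → List (Edge k) → List (Edge k)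
    processAcc cov acc [] = acc
    processAcc cov acc ((u , v) ∷ es) = processAcc (cover cov u v) (keep (not (cov u) ∨ not (cov v)) (u , v) acc) es

    coverAfter : (Fin k → Bool) → List (Edge k) → Fin k → Bool
    coverAfter cov [] = cov
    coverAfter cov ((u , v) ∷ es) = coverAfter (cover cov u v) es

    processAcc-++ : ∀ cov acc xs ys → processAcc cov acc (xs ++ ys) ≡ processAcc (coverAfter cov xs) (processAcc cov acc xs) ys
    processAcc-++ cov acc [] ys = refl
    processAcc-++ cov acc ((u , v) ∷ xs) ys = processAcc-++ (cover cov u v) _ xs ys

    coverAfter-incident : ∀ cov es w → coverAfter cov es w ≡ cov w ∨ incident es w
    coverAfter-incident cov [] w = sym (∨-identityʳ (cov w))
    coverAfter-incident cov ((u , v) ∷ es) w =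
      trans (coverAfter-incident (cover cov u v) es w) (∨-assoc (cov w) ((w == u) ∨ (w == v)) (incident es w))

    process≈processAcc : ∀ es cov acc → (process cov es ++ acc) ≈ processAcc cov acc es
    process≈processAcc [] cov acc p _ = refl
    process≈processAcc ((u , v) ∷ es) cov acc p unoriented with not (cov u) ∨ not (cov v)
    ... | true = trans (any-∷-++ p (u , v) (process (cover cov u v) es) acc)
                       (process≈processAcc es (cover cov u v) ((u , v) ∷ acc) p unoriented)
    ... | false = process≈processAcc es (cover cov u v) acc p unoriented

    ∅ : Fin k → Bool
    ∅ _ = false

    components-process : ∀ es → components (process ∅ es) ≡ components (processAcc ∅ [] es)
    components-process es = trans (cong components (sym (++-identityʳ (process ∅ es))))
                                  (components-≈ (process ∅ es ++ []) (processAcc ∅ [] es) (process≈processAcc es ∅ []))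

    cover-absorb : ∀ cov u v → cov u ≡ true → cov v ≡ true → ∀ w → cover cov u v w ≡ cov w
    cover-absorb cov u v cu cv w = bool-ext absorbed (∨-true⁺ˡ ((w == u) ∨ (w == v)))
      where
      absorbed : cover cov u v w ≡ true → cov w ≡ true
      absorbed e with ∨-true⁻ (cov w) _ e
      ... | inj₁ c = c
      ... | inj₂ r with ∨-true⁻ (w == u) (w == v) r
      ...   | inj₁ w=u = subst (λ z → cov z ≡ true) (sym (==⇒≡ {a = w} w=u)) cu
      ...   | inj₂ w=v = subst (λ z → cov z ≡ true) (sym (==⇒≡ {a = w} w=v)) cv

    not∨not-true⁻ : ∀ a b → not a ∨ not b ≡ true → a ≡ false ⊎ b ≡ false
    not∨not-true⁻ false b _ = inj₁ refl
    not∨not-true⁻ true false _ = inj₂ refl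

    not∨not-false⁻ : ∀ a b → not a ∨ not b ≡ false → a ≡ true × b ≡ true
    not∨not-false⁻ true true _ = refl , refl

    processAcc-Grown : ∀ es cov acc → (∀ w → cov w ≡ incident acc w) → Grown acc →
      Grown (processAcc cov acc es) × (∀ w → coverAfter cov es w ≡ incident (processAcc cov acc es) w)
    processAcc-Grown [] cov acc covers grown = grown , covers
    processAcc-Grown ((u , v) ∷ es) cov acc covers grown with not (cov u) ∨ not (cov v) in kept
    ... | true = processAcc-Grown es (cover cov u v) ((u , v) ∷ acc) covers′ (fresh ∷ grown)
      where
      fresh : Fresh acc (u , v)
      fresh with not∨not-true⁻ (cov u) (cov v) kept
      ... | inj₁ u-new = inj₂ (trans (sym (covers u)) u-new)
      ... | inj₂ v-new = inj₁ (trans (sym (covers v)) v-new)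
      covers′ : ∀ w → cover cov u v w ≡ incident ((u , v) ∷ acc) w
      covers′ w rewrite covers w = ∨-comm (incident acc w) ((w == u) ∨ (w == v))
    ... | false = processAcc-Grown es (cover cov u v) acc covers′ grown
      where
      covers′ : ∀ w → cover cov u v w ≡ incident acc w
      covers′ w = let (cu , cv) = not∨not-false⁻ (cov u) (cov v) kept in trans (cover-absorb cov u v cu cv w) (covers w)

    components-process-∷ʳ-covered : ∀ q a b → incident q a ∨ incident q b ≡ true →
      components (process ∅ (q ++ [ (a , b) ])) ≡ components (process ∅ q)
    components-process-∷ʳ-covered q a b covered = begin
      components (process ∅ (q ++ [ (a , b) ]))                        ≡⟨ components-process (q ++ [ (a , b) ]) ⟩
      components (processAcc ∅ [] (q ++ [ (a , b) ]))                  ≡⟨ cong components (processAcc-++ ∅ [] q [ (a , b) ]) ⟩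
      components (keep (not (cq a) ∨ not (cq b)) (a , b) Fq)          ≡⟨ last-edge-neutral ⟩
      components Fq                                                     ≡⟨ components-process q ⟨
      components (process ∅ q)                                          ∎
      where
      Fq = processAcc ∅ [] q
      cq = coverAfter ∅ q
      cq-Fq : ∀ w → cq w ≡ incident Fq w
      cq-Fq = proj₂ (processAcc-Grown q ∅ [] (λ _ → refl) [])
      last-edge-neutral : components (keep (not (cq a) ∨ not (cq b)) (a , b) Fq) ≡ components Fq
      last-edge-neutral with not (cq a) ∨ not (cq b) in kept
      ... | false = refl
      ... | true = suc-injective (begin
        suc (components ((a , b) ∷ Fq))                                   ≡⟨ +-comm 1 _ ⟩
        components ((a , b) ∷ Fq) + χ true                               ≡⟨ cong (λ c → components ((a , b) ∷ Fq) + χ c) covered-Fq ⟨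
        components ((a , b) ∷ Fq) + χ (incident Fq a ∨ incident Fq b)    ≡⟨ components-fresh Fq a b fresh ⟩
        suc (components Fq)                                               ∎)
        where
        fresh : Fresh Fq (a , b)
        fresh with not∨not-true⁻ (cq a) (cq b) kept
        ... | inj₁ a-new = inj₂ (trans (sym (cq-Fq a)) a-new)
        ... | inj₂ b-new = inj₁ (trans (sym (cq-Fq b)) b-new)
        covered-Fq : incident Fq a ∨ incident Fq b ≡ true
        covered-Fq = trans (cong₂ _∨_ (trans (sym (cq-Fq a)) (coverAfter-incident ∅ q a))
                                      (trans (sym (cq-Fq b)) (coverAfter-incident ∅ q b))) covered

    module Relabelling (σ : Fin k → Fin k) (σ-injective : ∀ {x y} → σ x ≡ σ y → x ≡ y) where
      relabel : Edge k → Edge k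
      relabel (a , b) = (σ a , σ b)

      ==-σ : ∀ x y → (σ x == σ y) ≡ (x == y)
      ==-σ x y = bool-ext (λ e → ≡⇒== (σ-injective (==⇒≡ {a = σ x} e))) (λ e → ≡⇒== (cong σ (==⇒≡ {a = x} e)))

      incident-relabel : ∀ F w → incident (map relabel F) (σ w) ≡ incident F w
      incident-relabel F w = begin
        incident (map relabel F) (σ w)                ≡⟨ incident-touches (map relabel F) (σ w) ⟩
        any (touches (σ w)) (map relabel F)           ≡⟨ any-map (touches (σ w)) relabel F ⟩
        any (λ e → touches (σ w) (relabel e)) F      ≡⟨ any-cong (λ (a , b) → cong₂ _∨_ (==-σ w a) (==-σ w b)) F ⟩
        any (touches w) F                             ≡⟨ incident-touches F w ⟨
        incident F w                                  ∎

      -- σ need not preserve the order of vertices, which components uses to pick a representative;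
      -- so instead count components along the decomposition of a grown forest into fresh edges.
      components-relabel : ∀ {F} → Grown F → components (map relabel F) ≡ components F
      components-relabel [] = refl
      components-relabel {(a , b) ∷ F} (fresh ∷ grown) = +-cancelʳ-≡ _ _ _ (begin
        components ((σ a , σ b) ∷ map relabel F) + χ (incident F a ∨ incident F b)
          ≡⟨ cong (λ c → components ((σ a , σ b) ∷ map relabel F) + χ c)
                  (cong₂ _∨_ (incident-relabel F a) (incident-relabel F b)) ⟨
        components ((σ a , σ b) ∷ map relabel F) + χ (incident (map relabel F) (σ a) ∨ incident (map relabel F) (σ b))
          ≡⟨ components-fresh (map relabel F) (σ a) (σ b) fresh′ ⟩
        suc (components (map relabel F))                      ≡⟨ cong suc (components-relabel grown) ⟩
        suc (components F)                                    ≡⟨ components-fresh F a b fresh ⟨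
        components ((a , b) ∷ F) + χ (incident F a ∨ incident F b) ∎)
        where
        fresh′ : Fresh (map relabel F) (σ a , σ b)
        fresh′ = Data.Sum.map (trans (incident-relabel F b)) (trans (incident-relabel F a)) fresh

      ρ : Edge k → Edge k
      ρ e = orient (relabel e)

      ρ-cases : ∀ a b → ρ (a , b) ≡ (σ a , σ b) ⊎ ρ (a , b) ≡ (σ b , σ a)
      ρ-cases a b = orient-cases (σ a) (σ b)

      relabel-SameEdge⁻ : ∀ x y → SameEdge (relabel x) (relabel y) → SameEdge x y
      relabel-SameEdge⁻ _ _ (inj₁ (e₁ , e₂)) = inj₁ (σ-injective e₁ , σ-injective e₂)
      relabel-SameEdge⁻ _ _ (inj₂ (e₁ , e₂)) = inj₂ (σ-injective e₁ , σ-injective e₂)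

      relabel-SameEdge⁺ : ∀ x y → SameEdge x y → SameEdge (relabel x) (relabel y)
      relabel-SameEdge⁺ _ _ (inj₁ (refl , refl)) = inj₁ (refl , refl)
      relabel-SameEdge⁺ _ _ (inj₂ (refl , refl)) = inj₂ (refl , refl)

      ρ-SameEdge : ∀ x → SameEdge (ρ x) (relabel x)
      ρ-SameEdge x = orient-SameEdge (relabel x)

      map-ρ≈map-relabel : ∀ F → map ρ F ≈ map relabel F
      map-ρ≈map-relabel F p unoriented = begin
        any p (map ρ F)                ≡⟨ any-map p ρ F ⟩
        any (λ e → p (ρ e)) F          ≡⟨ any-cong (λ (a , b) → same-edge a b (ρ-cases a b)) F ⟩
        any (λ e → p (relabel e)) F    ≡⟨ any-map p relabel F ⟨
        any p (map relabel F)          ∎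
        where
        same-edge : ∀ a b → ρ (a , b) ≡ (σ a , σ b) ⊎ ρ (a , b) ≡ (σ b , σ a) → p (ρ (a , b)) ≡ p (σ a , σ b)
        same-edge a b (inj₁ e) = cong p e
        same-edge a b (inj₂ e) = trans (cong p e) (unoriented (σ b) (σ a))

      keep-ρ : ∀ c u v acc {e} → ρ (u , v) ≡ e → keep c e (map ρ acc) ≡ map ρ (keep c (u , v) acc)
      keep-ρ true u v acc ρuv = cong (_∷ map ρ acc) (sym ρuv)
      keep-ρ false u v acc ρuv = refl

      processAcc-relabel : ∀ es cov cov′ acc → (∀ w → cov′ (σ w) ≡ cov w) →
        processAcc cov′ (map ρ acc) (map ρ es) ≡ map ρ (processAcc cov acc es)
      processAcc-relabel [] cov cov′ acc inv = refl
      processAcc-relabel ((u , v) ∷ es) cov cov′ acc inv = oriented (ρ-cases u v)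
        where
        edge-step : ∀ x y → ρ (u , v) ≡ (x , y) → not (cov′ x) ∨ not (cov′ y) ≡ not (cov u) ∨ not (cov v) →
          (∀ w → cover cov′ x y (σ w) ≡ cover cov u v w) →
          processAcc cov′ (map ρ acc) (map ρ ((u , v) ∷ es)) ≡ map ρ (processAcc cov acc ((u , v) ∷ es))
        edge-step x y ρuv kept inv′ rewrite ρuv | kept =
          trans (cong (λ acc′ → processAcc (cover cov′ x y) acc′ (map ρ es)) (keep-ρ _ u v acc ρuv))
                (processAcc-relabel es _ _ _ inv′)
        oriented : ρ (u , v) ≡ (σ u , σ v) ⊎ ρ (u , v) ≡ (σ v , σ u) →
          processAcc cov′ (map ρ acc) (map ρ ((u , v) ∷ es)) ≡ map ρ (processAcc cov acc ((u , v) ∷ es))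
        oriented (inj₁ ρuv) = edge-step (σ u) (σ v) ρuv (cong₂ (λ x y → not x ∨ not y) (inv u) (inv v))
          (λ w → cong₂ _∨_ (inv w) (cong₂ _∨_ (==-σ w u) (==-σ w v)))
        oriented (inj₂ ρuv) = edge-step (σ v) (σ u) ρuv
          (trans (cong₂ (λ x y → not x ∨ not y) (inv v) (inv u)) (∨-comm (not (cov v)) (not (cov u))))
          (λ w → cong₂ _∨_ (inv w) (trans (cong₂ _∨_ (==-σ w v) (==-σ w u)) (∨-comm (w == v) (w == u))))

      components-process-relabel : ∀ p → components (process ∅ (map ρ p)) ≡ components (process ∅ p)
      components-process-relabel p = begin
        components (process ∅ (map ρ p))         ≡⟨ components-process (map ρ p) ⟩
        components (processAcc ∅ [] (map ρ p))   ≡⟨ cong components (processAcc-relabel p ∅ ∅ [] (λ _ → refl)) ⟩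
        components (map ρ F)                     ≡⟨ components-≈ (map ρ F) (map relabel F) (map-ρ≈map-relabel F) ⟩
        components (map relabel F)               ≡⟨ components-relabel (proj₁ (processAcc-Grown p ∅ [] (λ _ → refl) [])) ⟩
        components F                             ≡⟨ components-process p ⟨
        components (process ∅ p)                 ∎
        where
        F = processAcc ∅ [] p


module EdgeLists where

  open Booleans using (∧-true⁻; <ᵇ-true⇒<; <⇒<ᵇ-true)
  open import Data.Bool using (Bool; true; false; _∧_)
  open import Data.Nat using (_<_; _<ᵇ_)
  open import Data.Fin using (toℕ)
  open import Data.List using (List; []; _∷_; _++_; map; concatMap; allFin; cartesianProduct)
  open import Data.List.Membership.Propositional using (_∈_)
  open import Data.List.Membership.Propositional.Properties using (∈-allFin; ∈-cartesianProduct⁺; ∈-map⁻)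
  open import Data.List.Membership.Propositional.Properties.WithK using (unique∧set⇒bag)
  open import Data.List.Relation.Binary.BagAndSetEquality using (∼bag⇒↭)
  open import Data.List.Relation.Binary.Permutation.Propositional using (_↭_)
  open import Data.List.Relation.Unary.All as All using (All; []; _∷_)
  open import Data.List.Relation.Unary.Any using (here; there)
  open import Data.List.Relation.Unary.Unique.Propositional using (Unique)
  open import Data.List.Relation.Unary.AllPairs using ([]; _∷_)
  open import Data.List.Relation.Unary.Unique.Propositional.Properties using (cartesianProduct⁺; allFin⁺)
  open import Data.Product using (_×_; _,_; proj₂)
  open import Function.Bundles using (mk⇔)
  open import Relation.Binary.PropositionalEquality using (_≡_; _≢_; refl; sym; cong; cong₂; subst)

  unique-⊆⇒↭ : ∀ {A : Set} {xs ys : List A} → Unique xs → Unique ys →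
    (∀ {z} → z ∈ xs → z ∈ ys) → (∀ {z} → z ∈ ys → z ∈ xs) → xs ↭ ys
  unique-⊆⇒↭ u₁ u₂ f g = ∼bag⇒↭ (unique∧set⇒bag u₁ u₂ (mk⇔ f g))

  unique-map⁺ : ∀ {A B : Set} (f : A → B) {xs} → (∀ {x y} → x ∈ xs → y ∈ xs → f x ≡ f y → x ≡ y) →
    Unique xs → Unique (map f xs)
  unique-map⁺ f {[]} _ [] = []
  unique-map⁺ f {x ∷ xs} injective (x∉xs ∷ unique) =
    All.tabulate fx∉ ∷ unique-map⁺ f (λ x∈ y∈ → injective (there x∈) (there y∈)) unique
    where
    fx∉ : ∀ {z} → z ∈ map f xs → f x ≢ z
    fx∉ z∈ fx=z with ∈-map⁻ f z∈
    ... | w , w∈xs , refl = All.lookup x∉xs w∈xs (injective (here refl) (there w∈xs) fx=z)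

  module _ {A : Set} where
    ∈-filterᵇ⁻ : ∀ (p : A → Bool) xs {x} → x ∈ filterᵇ p xs → x ∈ xs × p x ≡ true
    ∈-filterᵇ⁻ p (y ∷ xs) m with p y in eq
    ∈-filterᵇ⁻ p (y ∷ xs) (here refl) | true = here refl , eq
    ∈-filterᵇ⁻ p (y ∷ xs) (there m) | true = let (m′ , px) = ∈-filterᵇ⁻ p xs m in there m′ , px
    ∈-filterᵇ⁻ p (y ∷ xs) m | false = let (m′ , px) = ∈-filterᵇ⁻ p xs m in there m′ , px

    ∈-filterᵇ⁺ : ∀ (p : A → Bool) {xs x} → x ∈ xs → p x ≡ true → x ∈ filterᵇ p xs
    ∈-filterᵇ⁺ p {y ∷ xs} (here refl) px rewrite px = here refl
    ∈-filterᵇ⁺ p {y ∷ xs} (there m) px with p y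
    ... | true = there (∈-filterᵇ⁺ p m px)
    ... | false = ∈-filterᵇ⁺ p m px

    All-filterᵇ : ∀ {P : A → Set} (p : A → Bool) {xs} → All P xs → All P (filterᵇ p xs)
    All-filterᵇ p [] = []
    All-filterᵇ p {y ∷ xs} (py ∷ a) with p y
    ... | true = py ∷ All-filterᵇ p a
    ... | false = All-filterᵇ p a

    unique-filterᵇ : ∀ (p : A → Bool) {xs} → Unique xs → Unique (filterᵇ p xs)
    unique-filterᵇ p [] = []
    unique-filterᵇ p {y ∷ xs} (a ∷ u) with p y
    ... | true = All-filterᵇ p a ∷ unique-filterᵇ p u
    ... | false = unique-filterᵇ p u

  concatMap≡cartesianProduct : ∀ {A B : Set} (xs : List A) (ys : List B) →
    concatMap (λ i → map (λ j → (i , j)) ys) xs ≡ cartesianProduct xs ys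
  concatMap≡cartesianProduct [] ys = refl
  concatMap≡cartesianProduct (x ∷ xs) ys = cong (map (x ,_) ys ++_) (concatMap≡cartesianProduct xs ys)

  module _ (G : Graph) where
    private
      vertices = allFin (n G)
      pairs = concatMap (λ i → map (λ j → (i , j)) vertices) vertices

      ∈-pairs : ∀ i j → (i , j) ∈ pairs
      ∈-pairs i j = subst ((i , j) ∈_) (sym (concatMap≡cartesianProduct vertices vertices))
                          (∈-cartesianProduct⁺ (∈-allFin i) (∈-allFin j))

      pairs-unique : Unique pairs
      pairs-unique = subst Unique (sym (concatMap≡cartesianProduct vertices vertices))
                           (cartesianProduct⁺ (allFin⁺ (n G)) (allFin⁺ (n G)))

    ∈-edges⁻ : ∀ {i j} → (i , j) ∈ edges G → toℕ i < toℕ j × adj G i j ≡ true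
    ∈-edges⁻ {i} {j} m = let (i<j , ij) = ∧-true⁻ _ _ (proj₂ (∈-filterᵇ⁻ _ pairs m)) in <ᵇ-true⇒< i<j , ij

    ∈-edges⁺ : ∀ {i j} → toℕ i < toℕ j → adj G i j ≡ true → (i , j) ∈ edges G
    ∈-edges⁺ {i} {j} i<j ij = ∈-filterᵇ⁺ _ (∈-pairs i j) (cong₂ _∧_ (<⇒<ᵇ-true i<j) ij)

    edges-unique : Unique (edges G)
    edges-unique = unique-filterᵇ _ pairs-unique


module Fractions where

  open import Data.Nat using (suc; _+_; _*_; _!; NonZero)
  open import Data.Nat.Properties using (*-assoc; *-comm; _!≢0; m*n≢0)
  open import Data.Integer using (+_)
  import Data.Integer as ℤ
  open import Data.Integer.Properties using (pos-*)
  open import Data.Rational using (_/_)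
  open import Data.Rational.Properties using (fromℚᵘ-cong)
  open import Data.Rational.Unnormalised using (mkℚᵘ; *≡*)
  open import Relation.Binary.PropositionalEquality

  /-cancel-suc : ∀ m a d → + (suc m * a) / (suc m * suc d) ≡ + a / suc d
  /-cancel-suc m a d = fromℚᵘ-cong {mkℚᵘ (+ (suc m * a)) (d + m * suc d)} {mkℚᵘ (+ a) d} (*≡* (begin
    + (suc m * a) ℤ.* + suc d      ≡⟨ pos-* (suc m * a) (suc d) ⟨
    + (suc m * a * suc d)          ≡⟨ cong +_ (trans (cong (_* suc d) (*-comm (suc m) a)) (*-assoc a (suc m) (suc d))) ⟩
    + (a * (suc m * suc d))        ≡⟨ pos-* a (suc m * suc d) ⟩
    + a ℤ.* + (suc m * suc d)      ∎))
    where open ≡-Reasoning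

  /-!-cancel : ∀ {l a} m b .{{_ : NonZero (l !)}} → l ≡ suc m → a ≡ suc m * b → + a / l ! ≡ (+ b / m !) {{m !≢0}}
  /-!-cancel m b refl refl = cancel (m !) {{m !≢0}}
    where
    cancel : ∀ f .{{_ : NonZero f}} → (+ (suc m * b) / (suc m * f)) {{m*n≢0 (suc m) f}} ≡ + b / f
    cancel (suc d) = /-cancel-suc m b d


module EdgeDeletion (G : Graph) (simple : IsSimple G) (edge-transitive : EdgeTransitive G)
                    (no-isolated-edge : NoIsolatedEdge G) (u v : Fin (n G)) (uv : adj G u v ≡ true) where

  open Booleans
  open PermutationSums
  open Reachability using (incident-fst; incident-snd)
  open Process
  open EdgeLists
  open Orientation
  open import Data.Bool using (Bool; true; false; _∧_; _∨_; not)
  open import Data.Nat using (suc; _*_; _≡ᵇ_)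
  open import Data.Fin.Properties using (¬∀⟶∃¬) renaming (_≟_ to _≟ᶠ_)
  open import Data.Fin.Permutation using (Permutation′; _⟨$⟩ʳ_; _⟨$⟩ˡ_; inverseˡ; inverseʳ)
  open import Data.List using (List; _∷_; _++_; [_]; map; length)
  open import Data.List.Properties using (length-map)
  open import Data.List.Membership.Propositional using (_∈_)
  open import Data.List.Membership.Propositional.Properties using (∈-map⁺; ∈-map⁻)
  open import Data.List.Relation.Unary.Unique.Propositional using (Unique)
  open import Data.List.Relation.Unary.AllPairs using (_∷_)
  open import Data.List.Relation.Unary.All as All using ()
  open import Data.List.Relation.Unary.Any using (here; there)
  open import Data.List.Relation.Binary.Permutation.Propositional using (_↭_; ↭-sym)
  open import Data.List.Relation.Binary.Permutation.Propositional.Properties using (∈-resp-↭; ↭-length)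
  open import Data.Product using (_×_; _,_; proj₁; proj₂; ∃)
  open import Data.Sum using (_⊎_; inj₁; inj₂)
  open import Data.Empty using (⊥-elim)
  open import Relation.Nullary using (Dec; yes; no; ¬_)
  open import Function using (_∘_)
  open import Relation.Binary.PropositionalEquality hiding ([_])

  E : List (Edge (n G))
  E = edges G

  H : Graph
  H = deleteEdge G u v

  E′ : List (Edge (n G))
  E′ = edges H

  adjacent : Edge (n G) → Bool
  adjacent (i , j) = adj G i j

  adj⇒≢ : ∀ {a b} → adj G a b ≡ true → a ≢ b
  adj⇒≢ {a} ab refl = true≢false (trans (sym ab) (proj₂ simple a))

  adjacent-orient : ∀ a b → adjacent (orient (a , b)) ≡ adj G a b
  adjacent-orient a b with orient-cases a b
  ... | inj₁ e rewrite e = refl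
  ... | inj₂ e rewrite e = proj₁ simple b a

  ∈E⁻ : ∀ {x} → x ∈ E → Ordered x × adjacent x ≡ true
  ∈E⁻ {i , j} = ∈-edges⁻ G

  ∈E⁺ : ∀ {x} → Ordered x → adjacent x ≡ true → x ∈ E
  ∈E⁺ {i , j} = ∈-edges⁺ G

  orient-∈E : ∀ {a b} → adj G a b ≡ true → orient (a , b) ∈ E
  orient-∈E {a} {b} ab = ∈E⁺ {orient (a , b)} (orient-Ordered a b (adj⇒≢ ab)) (trans (adjacent-orient a b) ab)

  ∈E′⁺ : ∀ {x} → Ordered x → adjacent x ∧ not (sameEdgeᵇ x (u , v)) ≡ true → x ∈ E′
  ∈E′⁺ {i , j} = ∈-edges⁺ H

  ∈E′⁻ : ∀ {x} → x ∈ E′ → Ordered x × adjacent x ≡ true × sameEdgeᵇ x (u , v) ≡ false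
  ∈E′⁻ {i , j} m = let (ordered , ij) = ∈-edges⁻ H m ; (adjacent-ij , not-uv) = ∧-true⁻ (adj G i j) _ ij in
    ordered , adjacent-ij , ¬true⇒false (λ same → true≢false (trans (sym not-uv) (cong not same)))

  incident-orient : ∀ (p : List (Edge (n G))) a w → orient (a , w) ∈ p → incident p a ≡ true
  incident-orient p a w m with orient-cases a w
  ... | inj₁ e = incident-fst p (subst (_∈ p) e m)
  ... | inj₂ e = incident-snd p (subst (_∈ p) e m)

  yieldsComponents : ℕ → List (Edge (n G)) → ℕ
  yieldsComponents c p = χ (components (process ∅ p) ≡ᵇ c)

  other-neighbour : ∀ x y → ¬ (∀ w → adj G x w ≡ true → w ≡ y) → ∃ λ w → adj G x w ≡ true × w ≢ y
  other-neighbour x y not-only with ¬∀⟶∃¬ (n G) _ decide not-only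
    where
    decide : ∀ w → Dec (adj G x w ≡ true → w ≡ y)
    decide w with adj G x w | w ≟ᶠ y
    ... | false | _ = yes (λ ())
    ... | true | yes w=y = yes (λ _ → w=y)
    ... | true | no w≢y = no (λ only → w≢y (only refl))
  ... | w , not-y with adj G x w in xw
  ...   | true = w , xw , (λ w=y → not-y (λ _ → w=y))
  ...   | false = ⊥-elim (not-y (λ ()))

  module LastEdge {a b : Fin (n G)} {r : List (Edge (n G))} (ab-r∈picks : ((a , b) , r) ∈ picks E) where
    ab∷r↭E : (a , b) ∷ r ↭ E
    ab∷r↭E = picks-↭ E ab-r∈picks

    ab∈E : (a , b) ∈ E
    ab∈E = ∈-resp-↭ ab∷r↭E (here refl)

    ab : adj G a b ≡ true
    ab = proj₂ (∈E⁻ ab∈E)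

    r⊆E : ∀ {e} → e ∈ r → e ∈ E
    r⊆E e∈r = ∈-resp-↭ ab∷r↭E (there e∈r)

    E⊆ab∷r : ∀ {e} → e ∈ E → e ≡ (a , b) ⊎ e ∈ r
    E⊆ab∷r e∈E with ∈-resp-↭ (↭-sym ab∷r↭E) e∈E
    ... | here e≡ab = inj₁ e≡ab
    ... | there e∈r = inj₂ e∈r

    incident-neighbour : ∀ (p : List (Edge (n G))) → p ↭ r →
      ∀ x w → adj G x w ≡ true → ¬ SameEdge (x , w) (a , b) → incident p x ≡ true
    incident-neighbour p p↭r x w xw other with E⊆ab∷r (orient-∈E xw)
    ... | inj₁ e≡ab = ⊥-elim (other (orient≡⇒SameEdge e≡ab))
    ... | inj₂ e∈r = incident-orient p x w (∈-resp-↭ (↭-sym p↭r) e∈r)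

    -- Without isolated edges, a or b has a neighbour off the edge ab, so every ordering of r covers ab.
    rest-covers : ∀ (p : List (Edge (n G))) → p ↭ r → incident p a ∨ incident p b ≡ true
    rest-covers p p↭r with incident p b in b-inc
    ... | true = ∨-true⁺ʳ (incident p a) refl
    ... | false = ∨-true⁺ˡ false (incident-neighbour p p↭r a w aw aw≁ab)
      where
      b-only-a : ∀ w → adj G b w ≡ true → w ≡ a
      b-only-a w bw with w ≟ᶠ a
      ... | yes w=a = w=a
      ... | no w≢a = ⊥-elim (true≢false (trans (sym (incident-neighbour p p↭r b w bw bw≁ab)) b-inc))
        where
        bw≁ab : ¬ SameEdge (b , w) (a , b)
        bw≁ab (inj₁ (b=a , _)) = adj⇒≢ ab (sym b=a)
        bw≁ab (inj₂ (_ , w=a)) = w≢a w=a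
      a-other : ∃ λ w → adj G a w ≡ true × w ≢ b
      a-other = other-neighbour a b (λ a-only-b → no-isolated-edge a b ab (a-only-b , b-only-a))
      w = proj₁ a-other
      aw = proj₁ (proj₂ a-other)
      aw≁ab : ¬ SameEdge (a , w) (a , b)
      aw≁ab (inj₁ (_ , w=b)) = proj₂ (proj₂ a-other) w=b
      aw≁ab (inj₂ (a=b , _)) = adj⇒≢ ab a=b

    private
      automorphism = edge-transitive a b u v ab uv

    π : Permutation′ (n G)
    π = proj₁ automorphism

    σ : Fin (n G) → Fin (n G)
    σ i = π ⟨$⟩ʳ i

    σ-adj : ∀ i j → adj G (σ i) (σ j) ≡ adj G i j
    σ-adj = proj₁ (proj₂ automorphism)

    σ-ab : SameEdge (σ a , σ b) (u , v)
    σ-ab = proj₂ (proj₂ automorphism)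

    σ-injective : ∀ {x y} → σ x ≡ σ y → x ≡ y
    σ-injective {x} {y} σx=σy = trans (sym (inverseˡ π)) (trans (cong (π ⟨$⟩ˡ_) σx=σy) (inverseˡ π))

    open Relabelling σ σ-injective

    ab-unique : Unique ((a , b) ∷ r)
    ab-unique = picks-unique E (edges-unique G) ab-r∈picks

    ab∉r : ∀ {w} → w ∈ r → w ≢ (a , b)
    ab∉r w∈r w=ab with ab-unique
    ... | ab∉ ∷ _ = All.lookup ab∉ w∈r (sym w=ab)

    ρ-injective : ∀ {x y} → x ∈ E → y ∈ E → ρ x ≡ ρ y → x ≡ y
    ρ-injective {x} {y} x∈E y∈E ρx=ρy = SameEdge-Ordered⇒≡ (proj₁ (∈E⁻ x∈E)) (proj₁ (∈E⁻ y∈E))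
      (relabel-SameEdge⁻ x y (SameEdge-trans (SameEdge-sym (ρ-SameEdge x)) (SameEdge-trans (≡⇒SameEdge ρx=ρy) (ρ-SameEdge y))))

    ρ-not-uv : ∀ {w} → w ∈ r → sameEdgeᵇ (ρ w) (u , v) ≡ false
    ρ-not-uv {w} w∈r = ¬true⇒false (λ same → ab∉r w∈r (SameEdge-Ordered⇒≡ (proj₁ (∈E⁻ (r⊆E w∈r))) (proj₁ (∈E⁻ ab∈E))
      (relabel-SameEdge⁻ w (a , b) (SameEdge-trans (SameEdge-sym (ρ-SameEdge w))
        (SameEdge-trans (sameEdgeᵇ-true⁻ (ρ w) (u , v) same) (SameEdge-sym σ-ab))))))

    σ-edge : ∀ {x y} → (x , y) ∈ E → adj G (σ x) (σ y) ≡ true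
    σ-edge {x} {y} xy∈E = trans (σ-adj x y) (proj₂ (∈E⁻ xy∈E))

    ρ-Ordered : ∀ {x y} → (x , y) ∈ E → Ordered (ρ (x , y))
    ρ-Ordered {x} {y} xy∈E = orient-Ordered (σ x) (σ y) (adj⇒≢ (σ-edge xy∈E))

    map-ρ⊆E′ : ∀ {z} → z ∈ map ρ r → z ∈ E′
    map-ρ⊆E′ z∈ρr with ∈-map⁻ ρ z∈ρr
    ... | (x , y) , xy∈r , refl = ∈E′⁺ {ρ (x , y)} (ρ-Ordered (r⊆E xy∈r))
      (cong₂ _∧_ (trans (adjacent-orient (σ x) (σ y)) (σ-edge (r⊆E xy∈r))) (cong not (ρ-not-uv xy∈r)))

    E′⊆map-ρ : ∀ {z} → z ∈ E′ → z ∈ map ρ r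
    E′⊆map-ρ {i , j} ij∈E′ = subst (_∈ map ρ r) ρw=ij (∈-map⁺ ρ w∈r)
      where
      i′ = π ⟨$⟩ˡ i
      j′ = π ⟨$⟩ˡ j
      σi′j′ : relabel (i′ , j′) ≡ (i , j)
      σi′j′ = cong₂ _,_ (inverseʳ π) (inverseʳ π)
      i′j′ : adj G i′ j′ ≡ true
      i′j′ = trans (sym (σ-adj i′ j′)) (trans (cong₂ (adj G) (inverseʳ π) (inverseʳ π)) (proj₁ (proj₂ (∈E′⁻ ij∈E′))))
      w = orient (i′ , j′)
      w≢ab : w ≢ (a , b)
      w≢ab w=ab = true≢false (trans (sym (sameEdgeᵇ-true⁺ (i , j) (u , v) ij~uv)) (proj₂ (proj₂ (∈E′⁻ ij∈E′))))
        where
        ij~uv : SameEdge (i , j) (u , v)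
        ij~uv = SameEdge-trans (SameEdge-sym (≡⇒SameEdge σi′j′))
                  (SameEdge-trans (relabel-SameEdge⁺ (i′ , j′) (a , b) (orient≡⇒SameEdge w=ab)) σ-ab)
      w∈r : w ∈ r
      w∈r with E⊆ab∷r (orient-∈E i′j′)
      ... | inj₁ w=ab = ⊥-elim (w≢ab w=ab)
      ... | inj₂ w∈r = w∈r
      ρw=ij : ρ w ≡ (i , j)
      ρw=ij = SameEdge-Ordered⇒≡ (ρ-Ordered (r⊆E w∈r)) (proj₁ (∈E′⁻ ij∈E′))
        (SameEdge-trans (ρ-SameEdge w) (SameEdge-trans (relabel-SameEdge⁺ w (i′ , j′) (orient-SameEdge (i′ , j′)))
                                                       (≡⇒SameEdge σi′j′)))

    map-ρ↭E′ : map ρ r ↭ E′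
    map-ρ↭E′ = unique-⊆⇒↭ (unique-map⁺ ρ (λ x∈r y∈r → ρ-injective (r⊆E x∈r) (r⊆E y∈r)) r-unique) (edges-unique H)
                          map-ρ⊆E′ E′⊆map-ρ
      where
      r-unique : Unique r
      r-unique with ab-unique
      ... | _ ∷ unique = unique

    sumPerms-rest : ∀ c → sumPerms (λ p → yieldsComponents c (p ++ [ (a , b) ])) r ≡ sumPerms (yieldsComponents c) E′
    sumPerms-rest c = begin
      sumPerms (λ p → yieldsComponents c (p ++ [ (a , b) ])) r
        ≡⟨ sumPerms-cong↭ r (λ p p↭r → cong (λ x → χ (x ≡ᵇ c)) (components-process-∷ʳ-covered p a b (rest-covers p p↭r))) ⟩
      sumPerms (yieldsComponents c) r
        ≡⟨ sumPerms-cong (λ p → cong (λ x → χ (x ≡ᵇ c)) (components-process-relabel p)) r ⟨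
      sumPerms (yieldsComponents c ∘ map ρ) r    ≡⟨ sumPerms-map ρ r (yieldsComponents c) ⟨
      sumPerms (yieldsComponents c) (map ρ r)    ≡⟨ sumPerms-↭ map-ρ↭E′ (yieldsComponents c) ⟩
      sumPerms (yieldsComponents c) E′           ∎
      where open ≡-Reasoning

    length-rest : length r ≡ length E′
    length-rest = trans (sym (length-map ρ r)) (↭-length map-ρ↭E′)

  length-E : length E ≡ suc (length E′)
  length-E = length-byLast E (orient-∈E uv) (λ {y} → LastEdge.length-rest {proj₁ y} {proj₂ y})

  count-orderings : ∀ c → countᵇ (λ ord → components (process ∅ ord) ≡ᵇ c) (perms E)
                ≡ suc (length E′) * countᵇ (λ ord → components (process ∅ ord) ≡ᵇ c) (perms E′)
  count-orderings c = begin
    countᵇ (λ ord → components (process ∅ ord) ≡ᵇ c) (perms E)    ≡⟨ countᵇ≡sumMap _ (perms E) ⟩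
    sumPerms (yieldsComponents c) E
      ≡⟨ sumPerms-byLast-const E (yieldsComponents c) _ (orient-∈E uv) (λ {y} m → LastEdge.sumPerms-rest {proj₁ y} {proj₂ y} m c) ⟩
    length E * sumPerms (yieldsComponents c) E′                   ≡⟨ cong (_* sumPerms (yieldsComponents c) E′) length-E ⟩
    suc (length E′) * sumPerms (yieldsComponents c) E′            ≡⟨ cong (suc (length E′) *_) (countᵇ≡sumMap _ (perms E′)) ⟨
    suc (length E′) * countᵇ (λ ord → components (process ∅ ord) ≡ᵇ c) (perms E′) ∎
    where open ≡-Reasoning


open Fractions using (/-!-cancel)
open import Data.List using (length)

corollary8 : (G : Graph) → IsSimple G → EdgeTransitive G → HasEdge G → NoIsolatedEdge G →
    (u v : Fin (n G)) → adj G u v ≡ true →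
    ∀ (k : ℕ) → P G k ≡ P (deleteEdge G u v) k
corollary8 G simple edge-transitive _ no-isolated-edge u v uv c =
  /-!-cancel (length E′) _ ⦃ length E !≢0 ⦄ length-E (count-orderings c)
  where
  open EdgeDeletion G simple edge-transitive no-isolated-edge u v uv
  open import Data.Nat.Properties using (_!≢0)
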